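{- Let $s\ge0$ and $n\ge1$ be integers, and let $(\alpha,\beta)\in\mathcal{C}(s,n)\times\mathcal{C}(s,n)$ be chosen uniformly at random. Then $$\mathbb{E}\big[\mathrm{EMD}(\alpha,\beta)\big]=\frac{s(n-1)}{4s+4n-2}\cdot\frac{\binom{2s+2n}{2s+1}}{\binom{s+n-1}{s}^2}.$$
   Context: $\mathcal{C}(s,n)=\{(\alpha_1,\dots,\alpha_n)\in\mathbb{Z}_{\ge0}^n:\sum_i\alpha_i=s\}$ is the set of weak compositions of $s$ into $n$ parts (histograms with $n$ bins and $s$ data points). For $\alpha,\beta\in\mathcal{C}(s,n)$, $\mathrm{EMD}(\alpha,\beta)$ is the one-dimensional earth mover's distance, i.e. the minimum total cost of transforming $\alpha$ into $\beta$ when moving one unit from bin $i$ to bin $j$ costs $|i-j|$; explicitly $\mathrm{EMD}(\alpha,\beta)=\sum_{i=1}^{n-1}\big|\sum_{j=1}^{i}(\alpha_j-\beta_j)\big|$. -}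

module Defs where

open import Data.Nat using (ℕ; zero; suc; _∸_)
open import Data.Integer using (ℤ; _⊖_; ∣_∣)
open import Data.List using (List; []; _∷_; map; concatMap; upTo; length)
open import Data.Nat.ListAction using (sum)
open import Data.Vec using (Vec; toList; _∷_; [])
import Data.List as L

compositions : ℕ → (n : ℕ) → List (Vec ℕ n)
compositions zero    zero    = [] ∷ []
compositions (suc s) zero    = []
compositions s       (suc n) =
  concatMap (λ a → map (a ∷_) (compositions (s ∸ a) n)) (upTo (suc s))

prefixSum : ∀ {n} → ℕ → Vec ℕ n → ℕ
prefixSum i α = sum (L.take i (toList α))

EMD : ∀ {n} → Vec ℕ n → Vec ℕ n → ℕ
EMD {n} α β =
  sum (map (λ i → ∣ prefixSum i α ⊖ prefixSum i β ∣) (map suc (upTo (n ∸ 1))))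

totalEMD : ℕ → ℕ → ℕ
totalEMD s n = sum (concatMap (λ α → map (λ β → EMD α β) (compositions s n))
                              (compositions s n))

numCompositions : ℕ → ℕ → ℕ
numCompositions s n = length (compositions s n)

-- Read a composition of s into m + 1 parts as a word with s stars and m bars. Writing
-- ∣Aᵢ - Bᵢ∣ = Σₖ ∣[Aᵢ ≤ k] - [Bᵢ ≤ k]∣ for the prefix sums and transposing the double sum
-- turns EMD(α, β) into Σ_L ∣Xα(L) - Xβ(L)∣, where X(L) counts the stars among the first L
-- letters. A pair of words is classified by the numbers p, q, r, r of positions ⋆/⋆, |/|, ⋆/|
-- and |/⋆; peeling off first letters shows that the class has total distance
-- C(M + 1, 2r + 1) C(M - 2r, s - r) W(r), where M = s + m and W(r) sums the absolute heights
-- along all balanced ±1 walks of length 2r, and 2 W(r) = r 4ʳ. Summing over r with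
-- Σᵣ C(n, 2r) C(n - 2r, t - r) 4ʳ = C(2n, 2t), read off from (1 + x)²ⁿ = (1 + 2x + x²)ⁿ, and
-- its odd companion gives the closed form.
module Submission where

open import Defs
open import Data.Nat
open import Data.Nat.Properties
open import Data.Nat.Combinatorics using (_C_; nCk+nC[k+1]≡[n+1]C[k+1]; nCk≡nC[n∸k])
open import Data.Nat.ListAction using (sum)
open import Data.Nat.Tactic.RingSolver using (solve-∀)
import Data.Integer as ℤ
import Data.Integer.Properties as ℤ
open import Data.List using (List; []; _∷_; _++_; map; concatMap; upTo; applyUpTo; length)
open import Data.List.Properties
  using (map-∘; map-applyUpTo; concatMap-map; concatMap-cong; map-concatMap; length-map; length-++; ++-identityʳ)
open import Data.Vec using (Vec; []; _∷_) renaming (sum to sumᵥ)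
open import Data.Product using (_,_; _×_; ∃; proj₁; proj₂)
open import Data.Sum using (_⊎_; inj₁; inj₂)
open import Function using (_∘_; id)
open import Relation.Nullary using (Dec; yes; no; contradiction)
open import Relation.Binary.PropositionalEquality
open ≡-Reasoning

Σ< : ℕ → (ℕ → ℕ) → ℕ
Σ< zero    f = 0
Σ< (suc n) f = Σ< n f + f n

Σ<-cong : ∀ n {f g : ℕ → ℕ} → (∀ i → i < n → f i ≡ g i) → Σ< n f ≡ Σ< n g
Σ<-cong zero    eq = refl
Σ<-cong (suc n) eq = cong₂ _+_ (Σ<-cong n (λ i i<n → eq i (m<n⇒m<1+n i<n))) (eq n (n<1+n n))

Σ<-cong′ : ∀ n {f g : ℕ → ℕ} → (∀ i → f i ≡ g i) → Σ< n f ≡ Σ< n g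
Σ<-cong′ n eq = Σ<-cong n (λ i _ → eq i)

Σ<-zero : ∀ n (f : ℕ → ℕ) → (∀ i → i < n → f i ≡ 0) → Σ< n f ≡ 0
Σ<-zero zero    f eq = refl
Σ<-zero (suc n) f eq =
  cong₂ _+_ (Σ<-zero n f (λ i i<n → eq i (m<n⇒m<1+n i<n))) (eq n (n<1+n n))

Σ<-+ : ∀ n (f g : ℕ → ℕ) → Σ< n (λ i → f i + g i) ≡ Σ< n f + Σ< n g
Σ<-+ zero    f g = refl
Σ<-+ (suc n) f g rewrite Σ<-+ n f g = +-+-comm (Σ< n f) (Σ< n g) (f n) (g n)
  where
  +-+-comm : ∀ a b c d → a + b + (c + d) ≡ a + c + (b + d)
  +-+-comm = solve-∀

Σ<-*ˡ : ∀ n c (f : ℕ → ℕ) → Σ< n (λ i → c * f i) ≡ c * Σ< n f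
Σ<-*ˡ zero    c f = sym (*-zeroʳ c)
Σ<-*ˡ (suc n) c f rewrite Σ<-*ˡ n c f = sym (*-distribˡ-+ c (Σ< n f) (f n))

Σ<-*ʳ : ∀ n c (f : ℕ → ℕ) → Σ< n (λ i → f i * c) ≡ Σ< n f * c
Σ<-*ʳ n c f = begin
  Σ< n (λ i → f i * c) ≡⟨ Σ<-cong′ n (λ i → *-comm (f i) c) ⟩
  Σ< n (λ i → c * f i) ≡⟨ Σ<-*ˡ n c f ⟩
  c * Σ< n f           ≡⟨ *-comm c (Σ< n f) ⟩
  Σ< n f * c           ∎

Σ<-head : ∀ n (f : ℕ → ℕ) → Σ< (suc n) f ≡ f 0 + Σ< n (λ i → f (suc i))
Σ<-head zero    f = +-comm 0 (f 0)
Σ<-head (suc n) f rewrite Σ<-head n f = +-assoc (f 0) (Σ< n (λ i → f (suc i))) (f (suc n))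

Σ<-split : ∀ m n (f : ℕ → ℕ) → Σ< (m + n) f ≡ Σ< m f + Σ< n (λ i → f (m + i))
Σ<-split m zero    f rewrite +-identityʳ m = sym (+-identityʳ _)
Σ<-split m (suc n) f rewrite +-suc m n | Σ<-split m n f = +-assoc (Σ< m f) _ _

Σ<-comm : ∀ m n (f : ℕ → ℕ → ℕ) →
  Σ< m (λ i → Σ< n (λ j → f i j)) ≡ Σ< n (λ j → Σ< m (λ i → f i j))
Σ<-comm zero    n f = sym (Σ<-zero n _ (λ _ _ → refl))
Σ<-comm (suc m) n f rewrite Σ<-comm m n f = sym (Σ<-+ n (λ j → Σ< m (λ i → f i j)) (λ j → f m j))

Σ<-reverse : ∀ n (f : ℕ → ℕ) → Σ< n (λ i → f (n ∸ suc i)) ≡ Σ< n f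
Σ<-reverse zero    f = refl
Σ<-reverse (suc n) f = begin
  Σ< (suc n) (λ i → f (suc n ∸ suc i)) ≡⟨ Σ<-head n _ ⟩
  f n + Σ< n (λ i → f (n ∸ suc i))     ≡⟨ cong (f n +_) (Σ<-reverse n f) ⟩
  f n + Σ< n f                         ≡⟨ +-comm (f n) _ ⟩
  Σ< (suc n) f                         ∎

Σ<-mono-≤ : ∀ n (f g : ℕ → ℕ) → (∀ i → i < n → f i ≤ g i) → Σ< n f ≤ Σ< n g
Σ<-mono-≤ zero    f g le = z≤n
Σ<-mono-≤ (suc n) f g le =
  +-mono-≤ (Σ<-mono-≤ n f g (λ i i<n → le i (m<n⇒m<1+n i<n))) (le n (n<1+n n))

Σ<-∸ : ∀ n (f g : ℕ → ℕ) → (∀ i → i < n → g i ≤ f i) →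
  Σ< n (λ i → f i ∸ g i) ≡ Σ< n f ∸ Σ< n g
Σ<-∸ zero    f g le = refl
Σ<-∸ (suc n) f g le = begin
  Σ< n (λ i → f i ∸ g i) + (f n ∸ g n) ≡⟨ cong (_+ (f n ∸ g n)) (Σ<-∸ n f g le′) ⟩
  (Σ< n f ∸ Σ< n g) + (f n ∸ g n)      ≡⟨ sym (+-∸-comm (f n ∸ g n) (Σ<-mono-≤ n g f le′)) ⟩
  (Σ< n f + (f n ∸ g n)) ∸ Σ< n g      ≡⟨ cong (_∸ Σ< n g) (sym (+-∸-assoc (Σ< n f) (le n (n<1+n n)))) ⟩
  (Σ< n f + f n ∸ g n) ∸ Σ< n g        ≡⟨ ∸-+-assoc (Σ< n f + f n) (g n) (Σ< n g) ⟩
  (Σ< n f + f n) ∸ (g n + Σ< n g)      ≡⟨ cong (Σ< n f + f n ∸_) (+-comm (g n) _) ⟩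
  (Σ< n f + f n) ∸ (Σ< n g + g n)      ∎
  where
  le′ : ∀ i → i < n → g i ≤ f i
  le′ i i<n = le i (m<n⇒m<1+n i<n)

Σ<-const : ∀ n c → Σ< n (λ _ → c) ≡ n * c
Σ<-const zero    c = refl
Σ<-const (suc n) c = trans (cong (_+ c) (Σ<-const n c)) (+-comm (n * c) c)

-- Binomial coefficients by Pascal's rule, which then holds by computation.
binom : ℕ → ℕ → ℕ
binom zero    zero    = 1
binom zero    (suc k) = 0
binom (suc n) zero    = 1
binom (suc n) (suc k) = binom n k + binom n (suc k)

binom≡C : ∀ n k → binom n k ≡ n C k
binom≡C zero    zero    = refl
binom≡C zero    (suc k) = refl
binom≡C (suc n) zero    = refl
binom≡C (suc n) (suc k) rewrite binom≡C n k | binom≡C n (suc k) = nCk+nC[k+1]≡[n+1]C[k+1] n k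

binom[n,0]≡1 : ∀ n → binom n 0 ≡ 1
binom[n,0]≡1 zero    = refl
binom[n,0]≡1 (suc n) = refl

n<k⇒binom[n,k]≡0 : ∀ {n k} → n < k → binom n k ≡ 0
n<k⇒binom[n,k]≡0 {zero}  {suc k} _ = refl
n<k⇒binom[n,k]≡0 {suc n} {suc k} (s≤s n<k)
  rewrite n<k⇒binom[n,k]≡0 n<k | n<k⇒binom[n,k]≡0 (m<n⇒m<1+n n<k) = refl

binom[n,n]≡1 : ∀ n → binom n n ≡ 1
binom[n,n]≡1 zero = refl
binom[n,n]≡1 (suc n) rewrite binom[n,n]≡1 n | n<k⇒binom[n,k]≡0 (n<1+n n) = refl

binom-sym : ∀ {n k} → k ≤ n → binom n k ≡ binom n (n ∸ k)
binom-sym {n} {k} k≤n rewrite binom≡C n k | binom≡C n (n ∸ k) = nCk≡nC[n∸k] k≤n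

binom-swap : ∀ a b → binom (a + b) a ≡ binom (b + a) b
binom-swap a b = begin
  binom (a + b) a           ≡⟨ binom-sym (m≤m+n a b) ⟩
  binom (a + b) (a + b ∸ a) ≡⟨ cong (binom (a + b)) (m+n∸m≡n a b) ⟩
  binom (a + b) b           ≡⟨ cong (λ z → binom z b) (+-comm a b) ⟩
  binom (b + a) b           ∎

binom-absorb : ∀ n k → suc k * binom (suc n) (suc k) ≡ suc n * binom n k
binom-absorb zero    zero    = refl
binom-absorb zero    (suc k) = *-zeroʳ (suc (suc k))
binom-absorb (suc n) zero = begin
  1 * binom (suc (suc n)) 1 ≡⟨ *-identityˡ _ ⟩
  1 + binom (suc n) 1       ≡⟨ cong suc (trans (sym (*-identityˡ _)) (binom-absorb n zero)) ⟩
  1 + suc n * binom n 0     ≡⟨ cong (λ z → 1 + suc n * z) (binom[n,0]≡1 n) ⟩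
  1 + suc n * 1             ≡⟨ cong suc (*-identityʳ (suc n)) ⟩
  suc (suc n)               ≡⟨ sym (*-identityʳ (suc (suc n))) ⟩
  suc (suc n) * 1           ∎
binom-absorb (suc n) (suc k) = begin
  suc (suc k) * (B (suc k) + B (suc (suc k)))
    ≡⟨ *-distribˡ-+ (suc (suc k)) (B (suc k)) (B (suc (suc k))) ⟩
  suc (suc k) * B (suc k) + suc (suc k) * B (suc (suc k))
    ≡⟨ cong (suc (suc k) * B (suc k) +_) (binom-absorb n (suc k)) ⟩
  B (suc k) + suc k * B (suc k) + suc n * binom n (suc k)
    ≡⟨ cong (λ z → B (suc k) + z + suc n * binom n (suc k)) (binom-absorb n k) ⟩
  B (suc k) + suc n * binom n k + suc n * binom n (suc k)
    ≡⟨ +-assoc (B (suc k)) _ _ ⟩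
  B (suc k) + (suc n * binom n k + suc n * binom n (suc k))
    ≡⟨ cong (B (suc k) +_) (sym (*-distribˡ-+ (suc n) (binom n k) (binom n (suc k)))) ⟩
  suc (suc n) * B (suc k) ∎
  where
  B = binom (suc n)

binom-absorb′ : ∀ n k → k * binom (suc n) k + suc n * binom n k ≡ suc n * binom (suc n) k
binom-absorb′ n zero rewrite binom[n,0]≡1 n = refl
binom-absorb′ n (suc k) = begin
  suc k * binom (suc n) (suc k) + suc n * binom n (suc k)
    ≡⟨ cong (_+ suc n * binom n (suc k)) (binom-absorb n k) ⟩
  suc n * binom n k + suc n * binom n (suc k)
    ≡⟨ sym (*-distribˡ-+ (suc n) (binom n k) (binom n (suc k))) ⟩
  suc n * binom (suc n) (suc k) ∎

binom-absorb″ : ∀ n j → suc j * binom n (suc j) + j * binom n j ≡ n * binom n j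
binom-absorb″ zero    zero    = refl
binom-absorb″ zero    (suc j) = cong₂ _+_ (*-zeroʳ (suc (suc j))) (*-zeroʳ (suc j))
binom-absorb″ (suc n) j = begin
  suc j * binom (suc n) (suc j) + j * binom (suc n) j
    ≡⟨ cong (_+ j * binom (suc n) j) (binom-absorb n j) ⟩
  suc n * binom n j + j * binom (suc n) j
    ≡⟨ +-comm (suc n * binom n j) _ ⟩
  j * binom (suc n) j + suc n * binom n j
    ≡⟨ binom-absorb′ n j ⟩
  suc n * binom (suc n) j ∎

binom-row-sum : ∀ n → Σ< (suc n) (binom n) ≡ 2 ^ n
binom-row-sum zero    = refl
binom-row-sum (suc n) = begin
  Σ< (suc (suc n)) (binom (suc n))
    ≡⟨ Σ<-head (suc n) (binom (suc n)) ⟩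
  1 + Σ< (suc n) (λ i → binom n i + binom n (suc i))
    ≡⟨ cong (1 +_) (Σ<-+ (suc n) (binom n) (λ i → binom n (suc i))) ⟩
  1 + (S + Σ< (suc n) (λ i → binom n (suc i)))
    ≡⟨ rearrange 1 S _ ⟩
  S + (1 + Σ< (suc n) (λ i → binom n (suc i)))
    ≡⟨ cong (S +_) shifted ⟩
  S + S
    ≡⟨ cong (λ z → z + z) (binom-row-sum n) ⟩
  2 ^ n + 2 ^ n
    ≡⟨ cong (2 ^ n +_) (sym (+-identityʳ (2 ^ n))) ⟩
  2 ^ suc n ∎
  where
  S = Σ< (suc n) (binom n)
  rearrange : ∀ a b c → a + (b + c) ≡ b + (a + c)
  rearrange = solve-∀
  shifted : 1 + Σ< (suc n) (λ i → binom n (suc i)) ≡ S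
  shifted = begin
    1 + (Σ< n (λ i → binom n (suc i)) + binom n (suc n))
      ≡⟨ cong (λ z → 1 + (Σ< n (λ i → binom n (suc i)) + z)) (n<k⇒binom[n,k]≡0 (n<1+n n)) ⟩
    1 + (Σ< n (λ i → binom n (suc i)) + 0)
      ≡⟨ cong (1 +_) (+-identityʳ _) ⟩
    1 + Σ< n (λ i → binom n (suc i))
      ≡⟨ cong (_+ Σ< n (λ i → binom n (suc i))) (sym (binom[n,0]≡1 n)) ⟩
    binom n 0 + Σ< n (λ i → binom n (suc i))
      ≡⟨ sym (Σ<-head n (binom n)) ⟩
    S ∎

-- Sums over walks

square : ℕ → ℕ
square t = t * t

sqBinomSum : ℕ → ℕ → ℕ
sqBinomSum n k = Σ< k (λ j → square (k ∸ j) * binom n j)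

sqBinomSum-pascal : ∀ n k → sqBinomSum (suc n) (suc k) ≡ sqBinomSum n (suc k) + sqBinomSum n k
sqBinomSum-pascal n k = begin
  sqBinomSum (suc n) (suc k)
    ≡⟨ Σ<-head k (λ j → square (suc k ∸ j) * binom (suc n) j) ⟩
  square (suc k) * 1 + Σ< k (λ j → square (k ∸ j) * (binom n j + binom n (suc j)))
    ≡⟨ cong (square (suc k) * 1 +_) (trans (Σ<-cong′ k (λ j → *-distribˡ-+ (square (k ∸ j)) _ _)) (Σ<-+ k _ _)) ⟩
  square (suc k) * 1 + (sqBinomSum n k + T)
    ≡⟨ cong (λ z → square (suc k) * z + (sqBinomSum n k + T)) (sym (binom[n,0]≡1 n)) ⟩
  square (suc k) * binom n 0 + (sqBinomSum n k + T)
    ≡⟨ rearrange (square (suc k) * binom n 0) (sqBinomSum n k) T ⟩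
  (square (suc k) * binom n 0 + T) + sqBinomSum n k
    ≡⟨ cong (_+ sqBinomSum n k) (sym (Σ<-head k (λ j → square (suc k ∸ j) * binom n j))) ⟩
  sqBinomSum n (suc k) + sqBinomSum n k ∎
  where
  T = Σ< k (λ j → square (k ∸ j) * binom n (suc j))
  rearrange : ∀ a b c → a + (b + c) ≡ (a + c) + b
  rearrange = solve-∀

oddWeightSum : ℕ → ℕ → ℕ
oddWeightSum n k = Σ< (suc k) (λ j → (2 * (k ∸ j) + 1) * binom n j)

sqBinomSum-suc : ∀ n k → sqBinomSum n (suc k) ≡ sqBinomSum n k + oddWeightSum n k
sqBinomSum-suc n k = begin
  sqBinomSum n (suc k)
    ≡⟨ Σ<-cong (suc k) (λ j j≤k → cong (λ z → square z * binom n j) (+-∸-assoc 1 (s≤s⁻¹ j≤k))) ⟩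
  Σ< (suc k) (λ j → square (suc (k ∸ j)) * binom n j)
    ≡⟨ Σ<-cong′ (suc k) (λ j → square-suc (k ∸ j) (binom n j)) ⟩
  Σ< (suc k) (λ j → square (k ∸ j) * binom n j + (2 * (k ∸ j) + 1) * binom n j)
    ≡⟨ Σ<-+ (suc k) _ _ ⟩
  Σ< (suc k) (λ j → square (k ∸ j) * binom n j) + oddWeightSum n k
    ≡⟨ cong (λ z → sqBinomSum n k + square z * binom n k + oddWeightSum n k) (n∸n≡0 k) ⟩
  sqBinomSum n k + 0 + oddWeightSum n k
    ≡⟨ cong (_+ oddWeightSum n k) (+-identityʳ (sqBinomSum n k)) ⟩
  sqBinomSum n k + oddWeightSum n k ∎
  where
  square-suc : ∀ t b → suc t * suc t * b ≡ t * t * b + (2 * t + 1) * b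
  square-suc = solve-∀

Σ<-[n∸2j]*binom : ∀ n k → 2 * k ≤ n → Σ< (suc k) (λ j → (n ∸ 2 * j) * binom n j) ≡ suc k * binom n (suc k)
Σ<-[n∸2j]*binom n zero _ = begin
  0 + n * binom n 0     ≡⟨ sym (binom-absorb″ n 0) ⟩
  1 * binom n 1 + 0     ≡⟨ +-identityʳ _ ⟩
  1 * binom n 1         ∎
Σ<-[n∸2j]*binom n (suc k) 2k+2≤n = begin
  Σ< (suc k) (λ j → (n ∸ 2 * j) * binom n j) + t * B
    ≡⟨ cong (_+ t * B) (Σ<-[n∸2j]*binom n k (≤-trans (*-monoʳ-≤ 2 (n≤1+n k)) 2k+2≤n)) ⟩
  suc k * B + t * B
    ≡⟨ +-cancelʳ-≡ (suc k * B) _ _ absorbed ⟩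
  suc (suc k) * binom n (suc (suc k)) ∎
  where
  t = n ∸ 2 * suc k
  B = binom n (suc k)
  absorbed : suc k * B + t * B + suc k * B ≡ suc (suc k) * binom n (suc (suc k)) + suc k * B
  absorbed = begin
    suc k * B + t * B + suc k * B ≡⟨ collect (suc k) t B ⟩
    (2 * suc k + t) * B           ≡⟨ cong (_* B) (m+[n∸m]≡n 2k+2≤n) ⟩
    n * B                         ≡⟨ sym (binom-absorb″ n (suc k)) ⟩
    suc (suc k) * binom n (suc (suc k)) + suc k * B ∎
    where
    collect : ∀ a b c → a * c + b * c + a * c ≡ (2 * a + b) * c
    collect = solve-∀

oddWeightSum-central : ∀ u → oddWeightSum (u + suc u) u ≡ suc u * binom (u + suc u) u
oddWeightSum-central u = begin
  oddWeightSum n u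
    ≡⟨ Σ<-cong (suc u) (λ j j≤u → cong (_* binom n j) (weight j (u ∸ j) (m+[n∸m]≡n (s≤s⁻¹ j≤u)))) ⟩
  Σ< (suc u) (λ j → (n ∸ 2 * j) * binom n j)
    ≡⟨ Σ<-[n∸2j]*binom n u 2u≤n ⟩
  suc u * binom n (suc u)
    ≡⟨ cong (suc u *_) (trans (binom-sym (m≤n+m (suc u) u)) (cong (binom n) (m+n∸n≡m u (suc u)))) ⟩
  suc u * binom n u ∎
  where
  n = u + suc u
  2u≤n : 2 * u ≤ n
  2u≤n = ≤-trans (≤-reflexive (cong (u +_) (+-identityʳ u))) (+-monoʳ-≤ u (n≤1+n u))
  weight : ∀ j t → j + t ≡ u → 2 * (u ∸ j) + 1 ≡ n ∸ 2 * j
  weight j t refl = begin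
    2 * (j + t ∸ j) + 1                     ≡⟨ cong (λ z → 2 * z + 1) (m+n∸m≡n j t) ⟩
    2 * t + 1                               ≡⟨ sym (m+n∸m≡n (2 * j) (2 * t + 1)) ⟩
    2 * j + (2 * t + 1) ∸ 2 * j             ≡⟨ cong (_∸ 2 * j) (expand j t) ⟩
    j + t + suc (j + t) ∸ 2 * j             ∎
    where
    expand : ∀ j t → 2 * j + (2 * t + 1) ≡ j + t + suc (j + t)
    expand = solve-∀

sqBinomSum-odd : ∀ u → sqBinomSum (suc (u + suc u)) (suc u) ≡ 2 * sqBinomSum (u + suc u) u + suc u * binom (u + suc u) u
sqBinomSum-odd u = begin
  sqBinomSum (suc n) (suc u)                      ≡⟨ sqBinomSum-pascal n u ⟩
  sqBinomSum n (suc u) + sqBinomSum n u           ≡⟨ cong (_+ sqBinomSum n u) (sqBinomSum-suc n u) ⟩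
  sqBinomSum n u + oddWeightSum n u + sqBinomSum n u
    ≡⟨ cong (λ z → sqBinomSum n u + z + sqBinomSum n u) (oddWeightSum-central u) ⟩
  sqBinomSum n u + suc u * binom n u + sqBinomSum n u
    ≡⟨ rearrange (sqBinomSum n u) (suc u * binom n u) ⟩
  2 * sqBinomSum n u + suc u * binom n u ∎
  where
  n = u + suc u
  rearrange : ∀ a b → a + b + a ≡ 2 * a + b
  rearrange = solve-∀

-- walkSum u v d₁ d₂ sums, over the binom (u + v) u words with u letters a and v letters b,
-- the values ∣ (d₁ + #a) - (d₂ + #b) ∣ taken over the proper prefixes of the word.
walkSum : ℕ → ℕ → ℕ → ℕ → ℕ
walkSum zero    zero    d₁ d₂ = 0
walkSum (suc u) zero    d₁ d₂ = ∣ d₁ - d₂ ∣ + walkSum u zero (suc d₁) d₂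
walkSum zero    (suc v) d₁ d₂ = ∣ d₁ - d₂ ∣ + walkSum zero v d₁ (suc d₂)
walkSum (suc u) (suc v) d₁ d₂ =
  ∣ d₁ - d₂ ∣ * binom (suc u + suc v) (suc u) + walkSum u (suc v) (suc d₁) d₂ + walkSum (suc u) v d₁ (suc d₂)

walkSum-sym : ∀ u v d₁ d₂ → walkSum u v d₁ d₂ ≡ walkSum v u d₂ d₁
walkSum-sym zero    zero    d₁ d₂ = refl
walkSum-sym (suc u) zero    d₁ d₂ = cong₂ _+_ (∣-∣-comm d₁ d₂) (walkSum-sym u zero (suc d₁) d₂)
walkSum-sym zero    (suc v) d₁ d₂ = cong₂ _+_ (∣-∣-comm d₁ d₂) (walkSum-sym zero v d₁ (suc d₂))
walkSum-sym (suc u) (suc v) d₁ d₂ = begin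
  ∣ d₁ - d₂ ∣ * binom (suc u + suc v) (suc u) + walkSum u (suc v) (suc d₁) d₂ + walkSum (suc u) v d₁ (suc d₂)
    ≡⟨ cong₂ _+_ (cong₂ _+_ (cong₂ _*_ (∣-∣-comm d₁ d₂) (binom-swap (suc u) (suc v)))
                            (walkSum-sym u (suc v) (suc d₁) d₂))
                 (walkSum-sym (suc u) v d₁ (suc d₂)) ⟩
  ∣ d₂ - d₁ ∣ * binom (suc v + suc u) (suc v) + walkSum (suc v) u d₂ (suc d₁) + walkSum v (suc u) (suc d₂) d₁
    ≡⟨ swap-last (∣ d₂ - d₁ ∣ * binom (suc v + suc u) (suc v)) _ _ ⟩
  ∣ d₂ - d₁ ∣ * binom (suc v + suc u) (suc v) + walkSum v (suc u) (suc d₂) d₁ + walkSum (suc v) u d₂ (suc d₁) ∎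
  where
  swap-last : ∀ a b c → a + b + c ≡ a + c + b
  swap-last = solve-∀

-- Walks from height d down to 0 with u up-steps.
WalkSumClosed : ℕ → ℕ → ℕ → Set
WalkSumClosed u d e =
  2 * walkSum u (u + d) (e + d) e
    ≡ d * (suc (u + (u + d)) * binom (u + (u + d)) u) + 4 * sqBinomSum (u + (u + d)) u

∣m+n-m∣≡n : ∀ m n → ∣ m + n - m ∣ ≡ n
∣m+n-m∣≡n m n = trans (∣-∣-comm (m + n) m) (∣m-m+n∣≡n m n)

walkSumClosed-descent : ∀ d e → WalkSumClosed 0 d (suc e) → WalkSumClosed 0 (suc d) e
walkSumClosed-descent d e ih = begin
  2 * (∣ e + suc d - e ∣ + W)      ≡⟨ cong (λ z → 2 * (z + W)) (∣m+n-m∣≡n e (suc d)) ⟩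
  2 * (suc d + W)                  ≡⟨ *-distribˡ-+ 2 (suc d) W ⟩
  2 * suc d + 2 * W                ≡⟨ cong (2 * suc d +_) ih′ ⟩
  2 * suc d + (d * (suc d * 1) + 4 * 0) ≡⟨ arith d ⟩
  suc d * (suc (suc d) * 1) + 4 * 0     ≡⟨ cong (λ z → suc d * (suc (suc d) * z) + 4 * 0) (sym (binom[n,0]≡1 (suc d))) ⟩
  suc d * (suc (suc d) * binom (suc d) 0) + 4 * 0 ∎
  where
  W = walkSum 0 d (e + suc d) (suc e)
  ih′ : 2 * W ≡ d * (suc d * 1) + 4 * 0
  ih′ = begin
    2 * W                               ≡⟨ cong (λ z → 2 * walkSum 0 d z (suc e)) (+-suc e d) ⟩
    2 * walkSum 0 d (suc e + d) (suc e) ≡⟨ ih ⟩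
    d * (suc d * binom d 0) + 4 * 0     ≡⟨ cong (λ z → d * (suc d * z) + 4 * 0) (binom[n,0]≡1 d) ⟩
    d * (suc d * 1) + 4 * 0             ∎
  arith : ∀ d → 2 * suc d + (d * (suc d * 1) + 4 * 0) ≡ suc d * (suc (suc d) * 1) + 4 * 0
  arith = solve-∀

walkSumClosed-level : ∀ u e → WalkSumClosed u 1 e → WalkSumClosed (suc u) 0 e
walkSumClosed-level u e ih rewrite +-identityʳ u | +-identityʳ e = begin
  2 * (∣ e - e ∣ * binom (suc u + suc u) (suc u) + W + walkSum (suc u) u e (suc e))
    ≡⟨ cong₂ (λ a b → 2 * (a * binom (suc u + suc u) (suc u) + W + b)) (∣n-n∣≡0 e) (walkSum-sym (suc u) u e (suc e)) ⟩
  2 * (0 + W + W)                            ≡⟨ twice W ⟩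
  2 * W + 2 * W                              ≡⟨ cong (λ z → z + z) ih′ ⟩
  R + R                                      ≡⟨ arith u B (sqBinomSum n u) ⟩
  0 + 4 * (2 * sqBinomSum n u + suc u * B)   ≡⟨ cong (λ z → 0 + 4 * z) (sym (sqBinomSum-odd u)) ⟩
  0 + 4 * sqBinomSum (suc n) (suc u)         ∎
  where
  n = u + suc u
  B = binom n u
  W = walkSum u (suc u) (suc e) e
  R = 1 * (suc n * B) + 4 * sqBinomSum n u
  ih′ : 2 * W ≡ R
  ih′ = subst₂ (λ a b → 2 * walkSum u a b e ≡ 1 * (suc (u + a) * binom (u + a) u) + 4 * sqBinomSum (u + a) u)
               (+-comm u 1) (+-comm e 1) ih
  twice : ∀ x → 2 * (0 + x + x) ≡ 2 * x + 2 * x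
  twice = solve-∀
  arith : ∀ u B S → 1 * (suc (u + suc u) * B) + 4 * S + (1 * (suc (u + suc u) * B) + 4 * S)
                    ≡ 0 + 4 * (2 * S + suc u * B)
  arith = solve-∀

walkSumClosed-step : ∀ u d e → WalkSumClosed u (suc (suc d)) e → WalkSumClosed (suc u) d (suc e) →
  WalkSumClosed (suc u) (suc d) e
walkSumClosed-step u d e ih₁ ih₂ = begin
  2 * (∣ e + suc d - e ∣ * (x + y) + W₁ + W₂)
    ≡⟨ cong (λ z → 2 * (z * (x + y) + W₁ + W₂)) (∣m+n-m∣≡n e (suc d)) ⟩
  2 * (suc d * (x + y) + W₁ + W₂)
    ≡⟨ distrib (suc d * (x + y)) W₁ W₂ ⟩
  2 * (suc d * (x + y)) + 2 * W₁ + 2 * W₂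
    ≡⟨ cong₂ (λ a b → 2 * (suc d * (x + y)) + a + b) (reindex₁ ih₁) (reindex₂ ih₂) ⟩
  2 * (suc d * (x + y)) + (suc (suc d) * (suc K * x) + 4 * Q₁) + (d * (suc K * y) + 4 * Q₂)
    ≡⟨ cong₂ (λ a b → 2 * (suc d * (x + y)) + (suc (suc d) * a + 4 * Q₁) + (d * b + 4 * Q₂)) absorbˣ absorbʸ ⟩
  2 * (suc d * (x + y)) + (suc (suc d) * (suc u * (x + y)) + 4 * Q₁) + (d * ((suc u + suc d) * (x + y)) + 4 * Q₂)
    ≡⟨ arith u d (x + y) Q₁ Q₂ ⟩
  suc d * (suc (suc K) * (x + y)) + 4 * (Q₂ + Q₁)
    ≡⟨ cong (λ z → suc d * (suc (suc K) * (x + y)) + 4 * z) (sym (sqBinomSum-pascal K u)) ⟩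
  suc d * (suc (suc K) * binom (suc K) (suc u)) + 4 * sqBinomSum (suc K) (suc u) ∎
  where
  K = u + suc (u + suc d)
  x = binom K u
  y = binom K (suc u)
  Q₁ = sqBinomSum K u
  Q₂ = sqBinomSum K (suc u)
  W₁ = walkSum u (suc (u + suc d)) (suc (e + suc d)) e
  W₂ = walkSum (suc u) (u + suc d) (e + suc d) (suc e)
  reindex₁ : WalkSumClosed u (suc (suc d)) e → 2 * W₁ ≡ suc (suc d) * (suc K * x) + 4 * Q₁
  reindex₁ h rewrite sym (+-suc u (suc d)) | sym (+-suc e (suc d)) = h
  reindex₂ : WalkSumClosed (suc u) d (suc e) → 2 * W₂ ≡ d * (suc K * y) + 4 * Q₂
  reindex₂ h rewrite +-suc u d | +-suc e d | +-suc u (suc (u + d)) = h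
  absorbˣ : suc K * x ≡ suc u * (x + y)
  absorbˣ = sym (binom-absorb K u)
  absorbʸ : suc K * y ≡ (suc u + suc d) * (x + y)
  absorbʸ = +-cancelˡ-≡ (suc u * (x + y)) _ _ (begin
    suc u * (x + y) + suc K * y                  ≡⟨ binom-absorb′ K (suc u) ⟩
    suc K * (x + y)                              ≡⟨ *-distribʳ-+ (x + y) (suc u) (suc u + suc d) ⟩
    suc u * (x + y) + (suc u + suc d) * (x + y)  ∎)
  distrib : ∀ a b c → 2 * (a + b + c) ≡ 2 * a + 2 * b + 2 * c
  distrib = solve-∀
  arith : ∀ u d B n₁ n₂ →
    2 * (suc d * B) + (suc (suc d) * (suc u * B) + 4 * n₁) + (d * ((suc u + suc d) * B) + 4 * n₂)
      ≡ suc d * (suc (suc u + (suc u + suc d)) * B) + 4 * (n₂ + n₁)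
  arith = solve-∀

walkSum-closed : ∀ u d e → WalkSumClosed u d e
walkSum-closed zero    zero    e = refl
walkSum-closed zero    (suc d) e = walkSumClosed-descent d e (walkSum-closed zero d (suc e))
walkSum-closed (suc u) zero    e = walkSumClosed-level u e (walkSum-closed u 1 e)
walkSum-closed (suc u) (suc d) e =
  walkSumClosed-step u d e (walkSum-closed u (suc (suc d)) e) (walkSum-closed (suc u) d (suc e))

2^[r+r]≡4^r : ∀ r → 2 ^ (r + r) ≡ 4 ^ r
2^[r+r]≡4^r r = trans (^-distribˡ-+-* 2 r r) (go r)
  where
  go : ∀ r → 2 ^ r * 2 ^ r ≡ 4 ^ r
  go zero    = refl
  go (suc r) = trans (regroup (2 ^ r)) (cong (4 *_) (go r))
    where
    regroup : ∀ x → 2 * x * (2 * x) ≡ 4 * (x * x)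
    regroup = solve-∀

binom-central-row : ∀ r → 2 * Σ< r (binom (r + r)) + binom (r + r) r ≡ 4 ^ r
binom-central-row r = begin
  2 * Σ< r f + f r                                     ≡⟨ spread (Σ< r f) (f r) ⟩
  Σ< r f + (f r + Σ< r f)                              ≡⟨ cong (λ z → Σ< r f + (f z + Σ< r f)) (sym (+-identityʳ r)) ⟩
  Σ< r f + (f (r + 0) + Σ< r f)                        ≡⟨ cong (λ z → Σ< r f + (f (r + 0) + z)) (sym upper-half) ⟩
  Σ< r f + (f (r + 0) + Σ< r (λ i → f (r + suc i)))    ≡⟨ cong (Σ< r f +_) (sym (Σ<-head r (λ i → f (r + i)))) ⟩
  Σ< r f + Σ< (suc r) (λ i → f (r + i))                ≡⟨ sym (Σ<-split r (suc r) f) ⟩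
  Σ< (r + suc r) f                                     ≡⟨ cong (λ z → Σ< z f) (+-suc r r) ⟩
  Σ< (suc (r + r)) f                                   ≡⟨ binom-row-sum (r + r) ⟩
  2 ^ (r + r)                                          ≡⟨ 2^[r+r]≡4^r r ⟩
  4 ^ r                                                ∎
  where
  f = binom (r + r)
  spread : ∀ a b → 2 * a + b ≡ a + (b + a)
  spread = solve-∀
  upper-half : Σ< r (λ i → f (r + suc i)) ≡ Σ< r f
  upper-half = trans (Σ<-cong r (λ i i<r → trans (binom-sym (+-monoʳ-≤ r i<r)) (cong f ([m+n]∸[m+o]≡n∸o r r (suc i)))))
                     (Σ<-reverse r f)

oddWeightSum-suc : ∀ n k → oddWeightSum n (suc k) ≡ oddWeightSum n k + 2 * Σ< (suc k) (binom n) + binom n (suc k)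
oddWeightSum-suc n k = begin
  Σ< (suc k) (λ j → (2 * (suc k ∸ j) + 1) * binom n j) + (2 * (suc k ∸ suc k) + 1) * binom n (suc k)
    ≡⟨ cong₂ _+_ (Σ<-cong (suc k) (λ j j≤k → cong (λ z → (2 * z + 1) * binom n j) (+-∸-assoc 1 (s≤s⁻¹ j≤k))))
                 (cong (λ z → (2 * z + 1) * binom n (suc k)) (n∸n≡0 k)) ⟩
  Σ< (suc k) (λ j → (2 * suc (k ∸ j) + 1) * binom n j) + 1 * binom n (suc k)
    ≡⟨ cong₂ _+_ (trans (Σ<-cong′ (suc k) (λ j → peel (k ∸ j) (binom n j)))
                        (trans (Σ<-+ (suc k) _ _) (cong (oddWeightSum n k +_) (Σ<-*ˡ (suc k) 2 (binom n)))))
                 (*-identityˡ (binom n (suc k))) ⟩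
  oddWeightSum n k + 2 * Σ< (suc k) (binom n) + binom n (suc k) ∎
  where
  peel : ∀ t b → (2 * suc t + 1) * b ≡ (2 * t + 1) * b + 2 * b
  peel = solve-∀

sqBinomSum-central-suc : ∀ r → sqBinomSum (suc (suc (r + r))) (suc r) ≡ 4 * sqBinomSum (r + r) r + 4 ^ r
sqBinomSum-central-suc zero    = refl
sqBinomSum-central-suc (suc r) = +-cancelʳ-≡ O₀ _ _ (begin
  Q (suc (suc n)) (suc (suc r)) + O₀
    ≡⟨ cong (_+ O₀) (sqBinomSum-pascal (suc n) (suc r)) ⟩
  Q (suc n) (suc (suc r)) + Q (suc n) (suc r) + O₀
    ≡⟨ cong₂ (λ a b → a + b + O₀) (sqBinomSum-pascal n (suc r)) (sqBinomSum-pascal n r) ⟩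
  Q n (suc (suc r)) + Q n (suc r) + (Q n (suc r) + Q n r) + O₀
    ≡⟨ cong (λ z → z + Q n (suc r) + (Q n (suc r) + Q n r) + O₀) (sqBinomSum-suc n (suc r)) ⟩
  Q n (suc r) + O₁ + Q n (suc r) + (Q n (suc r) + Q n r) + O₀
    ≡⟨ regroup (Q n (suc r)) O₁ (Q n r) O₀ ⟩
  3 * Q n (suc r) + O₁ + (Q n r + O₀)
    ≡⟨ cong₂ (λ a b → 3 * Q n (suc r) + a + b) (oddWeightSum-suc n r) (sym (sqBinomSum-suc n r)) ⟩
  3 * Q n (suc r) + (O₀ + 2 * Σ< (suc r) (binom n) + binom n (suc r)) + Q n (suc r)
    ≡⟨ regroup′ (Q n (suc r)) O₀ (Σ< (suc r) (binom n)) (binom n (suc r)) ⟩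
  4 * Q n (suc r) + (2 * Σ< (suc r) (binom n) + binom n (suc r)) + O₀
    ≡⟨ cong (λ z → 4 * Q n (suc r) + z + O₀) (binom-central-row (suc r)) ⟩
  4 * Q n (suc r) + 4 ^ suc r + O₀ ∎)
  where
  Q = sqBinomSum
  n = suc r + suc r
  O₀ = oddWeightSum n r
  O₁ = oddWeightSum n (suc r)
  regroup : ∀ a o₁ b o₀ → a + o₁ + a + (a + b) + o₀ ≡ 3 * a + o₁ + (b + o₀)
  regroup = solve-∀
  regroup′ : ∀ a o₀ t b → 3 * a + (o₀ + 2 * t + b) + a ≡ 4 * a + (2 * t + b) + o₀
  regroup′ = solve-∀

sqBinomSum-central : ∀ r → 4 * sqBinomSum (r + r) r ≡ r * 4 ^ r
sqBinomSum-central zero    = refl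
sqBinomSum-central (suc r) = begin
  4 * sqBinomSum (suc r + suc r) (suc r)        ≡⟨ cong (λ z → 4 * sqBinomSum (suc z) (suc r)) (+-suc r r) ⟩
  4 * sqBinomSum (suc (suc (r + r))) (suc r)    ≡⟨ cong (4 *_) (sqBinomSum-central-suc r) ⟩
  4 * (4 * sqBinomSum (r + r) r + 4 ^ r)        ≡⟨ cong (λ z → 4 * (z + 4 ^ r)) (sqBinomSum-central r) ⟩
  4 * (r * 4 ^ r + 4 ^ r)                       ≡⟨ arith r (4 ^ r) ⟩
  suc r * (4 * 4 ^ r)                           ∎
  where
  arith : ∀ r x → 4 * (r * x + x) ≡ suc r * (4 * x)
  arith = solve-∀

walkSum-balanced : ∀ r → 2 * walkSum r r 0 0 ≡ r * 4 ^ r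
walkSum-balanced r = begin
  2 * walkSum r r 0 0              ≡⟨ cong (λ z → 2 * walkSum r z 0 0) (sym (+-identityʳ r)) ⟩
  2 * walkSum r (r + 0) (0 + 0) 0  ≡⟨ walkSum-closed r 0 0 ⟩
  4 * sqBinomSum (r + (r + 0)) r   ≡⟨ cong (λ z → 4 * sqBinomSum (r + z) r) (+-identityʳ r) ⟩
  4 * sqBinomSum (r + r) r         ≡⟨ sqBinomSum-central r ⟩
  r * 4 ^ r                        ∎

-- The trinomial identity

trinom : ℕ → ℕ → ℕ → ℕ
trinom n a b = binom n a * binom (n ∸ a) b

prev : (ℕ → ℕ) → ℕ → ℕ
prev f zero    = 0
prev f (suc a) = f a

trinom-pascal : ∀ n a b → trinom (suc n) a b ≡ trinom n a b + prev (λ a′ → trinom n a′ b) a + prev (trinom n a) b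
trinom-pascal n zero    zero    rewrite binom[n,0]≡1 n = refl
trinom-pascal n zero    (suc b) rewrite binom[n,0]≡1 n = arith (binom n b) (binom n (suc b))
  where
  arith : ∀ x y → 1 * (x + y) ≡ 1 * y + 0 + 1 * x
  arith = solve-∀
trinom-pascal n (suc a) zero    rewrite binom[n,0]≡1 (n ∸ a) | binom[n,0]≡1 (n ∸ suc a) =
  arith (binom n a) (binom n (suc a))
  where
  arith : ∀ x y → (x + y) * 1 ≡ y * 1 + x * 1 + 0
  arith = solve-∀
trinom-pascal n (suc a) (suc b) = begin
  (binom n a + binom n (suc a)) * binom (n ∸ a) (suc b)
    ≡⟨ *-distribʳ-+ (binom (n ∸ a) (suc b)) (binom n a) (binom n (suc a)) ⟩
  binom n a * binom (n ∸ a) (suc b) + binom n (suc a) * binom (n ∸ a) (suc b)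
    ≡⟨ cong (binom n a * binom (n ∸ a) (suc b) +_) second ⟩
  binom n a * binom (n ∸ a) (suc b) + (trinom n (suc a) (suc b) + trinom n (suc a) b)
    ≡⟨ rearrange (binom n a * binom (n ∸ a) (suc b)) (trinom n (suc a) (suc b)) (trinom n (suc a) b) ⟩
  trinom n (suc a) (suc b) + binom n a * binom (n ∸ a) (suc b) + trinom n (suc a) b ∎
  where
  rearrange : ∀ x y z → x + (y + z) ≡ y + x + z
  rearrange = solve-∀
  second : binom n (suc a) * binom (n ∸ a) (suc b) ≡ trinom n (suc a) (suc b) + trinom n (suc a) b
  second with a <? n
  ... | yes a<n = begin
    binom n (suc a) * binom (n ∸ a) (suc b)
      ≡⟨ cong (λ z → binom n (suc a) * binom z (suc b)) (+-∸-assoc 1 a<n) ⟩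
    binom n (suc a) * (binom (n ∸ suc a) b + binom (n ∸ suc a) (suc b))
      ≡⟨ *-distribˡ-+ (binom n (suc a)) _ _ ⟩
    trinom n (suc a) b + trinom n (suc a) (suc b)
      ≡⟨ +-comm (trinom n (suc a) b) _ ⟩
    trinom n (suc a) (suc b) + trinom n (suc a) b ∎
  ... | no a≮n rewrite n<k⇒binom[n,k]≡0 (s≤s (≮⇒≥ a≮n)) = refl

double : ℕ → ℕ
double zero    = 0
double (suc r) = suc (suc (double r))

double≡+ : ∀ r → double r ≡ r + r
double≡+ zero    = refl
double≡+ (suc r) = cong suc (trans (cong suc (double≡+ r)) (sym (+-suc r r)))

-- Grouping the factors of (1 + x)²ⁿ = (1 + 2x + x²)ⁿ by how many of them contribute 2x,
-- evenSum n s and oddSum n s are the coefficients of x²ˢ and x²ˢ⁺¹.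
evenSum : ℕ → ℕ → ℕ
evenSum n s = Σ< (suc s) (λ r → trinom n (double r) (s ∸ r) * 4 ^ r)

oddSum : ℕ → ℕ → ℕ
oddSum n s = Σ< (suc s) (λ r → trinom n (suc (double r)) (s ∸ r) * (2 * 4 ^ r))

Σ<-prev-trinom : ∀ s (g : ℕ → ℕ → ℕ) (w : ℕ → ℕ) →
  Σ< (suc (suc s)) (λ r → prev (g r) (suc s ∸ r) * w r) ≡ Σ< (suc s) (λ r → g r (s ∸ r) * w r)
Σ<-prev-trinom s g w = begin
  Σ< (suc s) (λ r → prev (g r) (suc s ∸ r) * w r) + prev (g (suc s)) (s ∸ s) * w (suc s)
    ≡⟨ cong₂ _+_ (Σ<-cong (suc s) (λ r r≤s → cong (λ z → prev (g r) z * w r) (+-∸-assoc 1 (s≤s⁻¹ r≤s))))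
                 (cong (λ z → prev (g (suc s)) z * w (suc s)) (n∸n≡0 s)) ⟩
  Σ< (suc s) (λ r → g r (s ∸ r) * w r) + 0
    ≡⟨ +-identityʳ _ ⟩
  Σ< (suc s) (λ r → g r (s ∸ r) * w r) ∎

Σ<-trinom-pascal : ∀ n s (a : ℕ → ℕ) (w : ℕ → ℕ) →
  Σ< (suc (suc s)) (λ r → trinom (suc n) (a r) (suc s ∸ r) * w r)
    ≡ Σ< (suc (suc s)) (λ r → trinom n (a r) (suc s ∸ r) * w r)
      + Σ< (suc (suc s)) (λ r → prev (λ a′ → trinom n a′ (suc s ∸ r)) (a r) * w r)
      + Σ< (suc s) (λ r → trinom n (a r) (s ∸ r) * w r)
Σ<-trinom-pascal n s a w = begin
  Σ< (suc (suc s)) (λ r → trinom (suc n) (a r) (suc s ∸ r) * w r)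
    ≡⟨ Σ<-cong′ (suc (suc s)) (λ r → trans (cong (_* w r) (trinom-pascal n (a r) (suc s ∸ r)))
                                           (distrib (trinom n (a r) (suc s ∸ r)) (prev (λ a′ → trinom n a′ (suc s ∸ r)) (a r)) (B r) (w r))) ⟩
  Σ< (suc (suc s)) (λ r → T r + P r + B r * w r)
    ≡⟨ trans (Σ<-+ (suc (suc s)) (λ r → T r + P r) (λ r → B r * w r)) (cong (_+ Σ< (suc (suc s)) (λ r → B r * w r)) (Σ<-+ (suc (suc s)) T P)) ⟩
  Σ< (suc (suc s)) T + Σ< (suc (suc s)) P + Σ< (suc (suc s)) (λ r → B r * w r)
    ≡⟨ cong (Σ< (suc (suc s)) T + Σ< (suc (suc s)) P +_) (Σ<-prev-trinom s (λ r → trinom n (a r)) w) ⟩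
  Σ< (suc (suc s)) T + Σ< (suc (suc s)) P + Σ< (suc s) (λ r → trinom n (a r) (s ∸ r) * w r) ∎
  where
  T P B : ℕ → ℕ
  B r = prev (trinom n (a r)) (suc s ∸ r)
  T r = trinom n (a r) (suc s ∸ r) * w r
  P r = prev (λ a′ → trinom n a′ (suc s ∸ r)) (a r) * w r
  distrib : ∀ x y z c → (x + y + z) * c ≡ x * c + y * c + z * c
  distrib = solve-∀

evenSum-pascal : ∀ n s → evenSum (suc n) (suc s) ≡ evenSum n s + 2 * oddSum n s + evenSum n (suc s)
evenSum-pascal n s = begin
  evenSum (suc n) (suc s)
    ≡⟨ Σ<-trinom-pascal n s double (4 ^_) ⟩
  evenSum n (suc s) + Σ< (suc (suc s)) (λ r → prev (λ a′ → trinom n a′ (suc s ∸ r)) (double r) * 4 ^ r) + evenSum n s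
    ≡⟨ cong (λ z → evenSum n (suc s) + z + evenSum n s) middle ⟩
  evenSum n (suc s) + 2 * oddSum n s + evenSum n s
    ≡⟨ swap (evenSum n (suc s)) (2 * oddSum n s) (evenSum n s) ⟩
  evenSum n s + 2 * oddSum n s + evenSum n (suc s) ∎
  where
  swap : ∀ a b c → a + b + c ≡ c + b + a
  swap = solve-∀
  middle : Σ< (suc (suc s)) (λ r → prev (λ a′ → trinom n a′ (suc s ∸ r)) (double r) * 4 ^ r) ≡ 2 * oddSum n s
  middle = begin
    Σ< (suc (suc s)) (λ r → prev (λ a′ → trinom n a′ (suc s ∸ r)) (double r) * 4 ^ r)
      ≡⟨ Σ<-head (suc s) _ ⟩
    0 + Σ< (suc s) (λ r → trinom n (suc (double r)) (s ∸ r) * (4 * 4 ^ r))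
      ≡⟨ Σ<-cong′ (suc s) (λ r → halve (trinom n (suc (double r)) (s ∸ r)) (4 ^ r)) ⟩
    Σ< (suc s) (λ r → 2 * (trinom n (suc (double r)) (s ∸ r) * (2 * 4 ^ r)))
      ≡⟨ Σ<-*ˡ (suc s) 2 _ ⟩
    2 * oddSum n s ∎
    where
    halve : ∀ t x → t * (4 * x) ≡ 2 * (t * (2 * x))
    halve = solve-∀

oddSum-pascal : ∀ n s → oddSum (suc n) (suc s) ≡ oddSum n s + 2 * evenSum n (suc s) + oddSum n (suc s)
oddSum-pascal n s = begin
  oddSum (suc n) (suc s)
    ≡⟨ Σ<-trinom-pascal n s (λ r → suc (double r)) (λ r → 2 * 4 ^ r) ⟩
  oddSum n (suc s) + Σ< (suc (suc s)) (λ r → trinom n (double r) (suc s ∸ r) * (2 * 4 ^ r)) + oddSum n s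
    ≡⟨ cong (λ z → oddSum n (suc s) + z + oddSum n s) middle ⟩
  oddSum n (suc s) + 2 * evenSum n (suc s) + oddSum n s
    ≡⟨ swap (oddSum n (suc s)) (2 * evenSum n (suc s)) (oddSum n s) ⟩
  oddSum n s + 2 * evenSum n (suc s) + oddSum n (suc s) ∎
  where
  swap : ∀ a b c → a + b + c ≡ c + b + a
  swap = solve-∀
  middle : Σ< (suc (suc s)) (λ r → trinom n (double r) (suc s ∸ r) * (2 * 4 ^ r)) ≡ 2 * evenSum n (suc s)
  middle = trans (Σ<-cong′ (suc (suc s)) (λ r → pull (trinom n (double r) (suc s ∸ r)) (4 ^ r)))
                 (Σ<-*ˡ (suc (suc s)) 2 _)
    where
    pull : ∀ t x → t * (2 * x) ≡ 2 * (t * x)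
    pull = solve-∀

evenSum[n,0]≡1 : ∀ n → evenSum n 0 ≡ 1
evenSum[n,0]≡1 n rewrite binom[n,0]≡1 n = refl

oddSum-pascal₀ : ∀ n → oddSum (suc n) 0 ≡ 2 * evenSum n 0 + oddSum n 0
oddSum-pascal₀ n = begin
  0 + trinom (suc n) 1 0 * (2 * 1)                       ≡⟨ cong (λ z → 0 + z * (2 * 1)) (trinom-pascal n 1 0) ⟩
  0 + (trinom n 1 0 + trinom n 0 0 + 0) * (2 * 1)        ≡⟨ arith (trinom n 1 0) (trinom n 0 0) ⟩
  2 * (0 + trinom n 0 0 * 1) + (0 + trinom n 1 0 * (2 * 1)) ∎
  where
  arith : ∀ a b → 0 + (a + b + 0) * (2 * 1) ≡ 2 * (0 + b * 1) + (0 + a * (2 * 1))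
  arith = solve-∀

binom-pascal² : ∀ n k → binom n k + 2 * binom n (suc k) + binom n (suc (suc k)) ≡ binom (suc (suc n)) (suc (suc k))
binom-pascal² n k = regroup (binom n k) (binom n (suc k)) (binom n (suc (suc k)))
  where
  regroup : ∀ a b c → a + 2 * b + c ≡ a + b + (b + c)
  regroup = solve-∀

evenSum≡binom : ∀ n s → evenSum n s ≡ binom (double n) (double s)
oddSum≡binom  : ∀ n s → oddSum n s ≡ binom (double n) (suc (double s))

evenSum≡binom zero    zero    = refl
evenSum≡binom zero    (suc s) = Σ<-zero (suc (suc s)) _ (λ { zero _ → refl ; (suc r) _ → refl })
evenSum≡binom (suc n) zero    = evenSum[n,0]≡1 (suc n)
evenSum≡binom (suc n) (suc s) = begin
  evenSum (suc n) (suc s)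
    ≡⟨ evenSum-pascal n s ⟩
  evenSum n s + 2 * oddSum n s + evenSum n (suc s)
    ≡⟨ cong₂ (λ a b → a + 2 * b + evenSum n (suc s)) (evenSum≡binom n s) (oddSum≡binom n s) ⟩
  binom D (double s) + 2 * binom D (suc (double s)) + evenSum n (suc s)
    ≡⟨ cong (binom D (double s) + 2 * binom D (suc (double s)) +_) (evenSum≡binom n (suc s)) ⟩
  binom D (double s) + 2 * binom D (suc (double s)) + binom D (suc (suc (double s)))
    ≡⟨ binom-pascal² D (double s) ⟩
  binom (suc (suc D)) (suc (suc (double s))) ∎
  where
  D = double n

oddSum≡binom zero    s       = Σ<-zero (suc s) _ (λ _ _ → refl)
oddSum≡binom (suc n) zero    = begin
  oddSum (suc n) 0                ≡⟨ oddSum-pascal₀ n ⟩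
  2 * evenSum n 0 + oddSum n 0    ≡⟨ cong₂ (λ a b → 2 * a + b) (evenSum[n,0]≡1 n) (oddSum≡binom n 0) ⟩
  2 * 1 + binom D 1               ≡⟨ cong (λ z → 1 + (z + binom D 1)) (sym (binom[n,0]≡1 D)) ⟩
  binom (suc (suc D)) 1           ∎
  where
  D = double n
oddSum≡binom (suc n) (suc s) = begin
  oddSum (suc n) (suc s)
    ≡⟨ oddSum-pascal n s ⟩
  oddSum n s + 2 * evenSum n (suc s) + oddSum n (suc s)
    ≡⟨ cong₂ (λ a b → a + 2 * b + oddSum n (suc s)) (oddSum≡binom n s) (evenSum≡binom n (suc s)) ⟩
  binom D (suc (double s)) + 2 * binom D (suc (suc (double s))) + oddSum n (suc s)
    ≡⟨ cong (binom D (suc (double s)) + 2 * binom D (suc (suc (double s))) +_) (oddSum≡binom n (suc s)) ⟩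
  binom D (suc (double s)) + 2 * binom D (suc (suc (double s))) + binom D (suc (suc (suc (double s))))
    ≡⟨ binom-pascal² D (suc (double s)) ⟩
  binom (suc (suc D)) (suc (suc (suc (double s)))) ∎
  where
  D = double n

binom-ratio : ∀ a b → suc a * suc b * binom (suc (suc (a + b))) (suc a) ≡ suc (suc (a + b)) * suc (a + b) * binom (a + b) a
binom-ratio a b = begin
  suc a * suc b * binom (suc (suc n)) (suc a) ≡⟨ swap (suc a) (suc b) _ ⟩
  suc b * (suc a * binom (suc (suc n)) (suc a)) ≡⟨ cong (suc b *_) (binom-absorb (suc n) a) ⟩
  suc b * (suc (suc n) * X)                    ≡⟨ swap′ (suc b) (suc (suc n)) X ⟩
  suc (suc n) * (suc b * X)                    ≡⟨ cong (suc (suc n) *_) lower ⟩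
  suc (suc n) * (suc n * binom n a)            ≡⟨ sym (*-assoc (suc (suc n)) (suc n) _) ⟩
  suc (suc n) * suc n * binom n a              ∎
  where
  n = a + b
  X = binom (suc n) a
  swap : ∀ x y z → x * y * z ≡ y * (x * z)
  swap = solve-∀
  swap′ : ∀ x y z → x * (y * z) ≡ y * (x * z)
  swap′ = solve-∀
  lower : suc b * X ≡ suc n * binom n a
  lower = +-cancelˡ-≡ (a * X) _ _ (begin
    a * X + suc b * X       ≡⟨ sym (*-distribʳ-+ X a (suc b)) ⟩
    (a + suc b) * X         ≡⟨ cong (_* X) (+-suc a b) ⟩
    suc n * X               ≡⟨ sym (binom-absorb′ n a) ⟩
    a * X + suc n * binom n a ∎)

-- Term r is the total distance over the pairs of words with r positions ⋆/| and r positions |/⋆.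
emdFormula : ℕ → ℕ → ℕ
emdFormula s m = Σ< (suc s) (λ r → trinom (suc (s + m)) (suc (double r)) (s ∸ r) * walkSum r r 0 0)

emdFormula-recombine : ∀ s m → 8 * emdFormula s m + oddSum (suc (s + m)) s ≡ 2 * suc (s + m) * evenSum (s + m) s
emdFormula-recombine s m = begin
  8 * emdFormula s m + oddSum (suc M) s
    ≡⟨ cong (_+ oddSum (suc M) s) (sym (Σ<-*ˡ (suc s) 8 _)) ⟩
  Σ< (suc s) (λ r → 8 * (t r * walkSum r r 0 0)) + oddSum (suc M) s
    ≡⟨ sym (Σ<-+ (suc s) _ _) ⟩
  Σ< (suc s) (λ r → 8 * (t r * walkSum r r 0 0) + t r * (2 * 4 ^ r))
    ≡⟨ Σ<-cong′ (suc s) term ⟩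
  Σ< (suc s) (λ r → 2 * suc M * (trinom M (double r) (s ∸ r) * 4 ^ r))
    ≡⟨ Σ<-*ˡ (suc s) (2 * suc M) _ ⟩
  2 * suc M * evenSum M s ∎
  where
  M = s + m
  t : ℕ → ℕ
  t r = trinom (suc M) (suc (double r)) (s ∸ r)
  term : ∀ r → 8 * (t r * walkSum r r 0 0) + t r * (2 * 4 ^ r) ≡ 2 * suc M * (trinom M (double r) (s ∸ r) * 4 ^ r)
  term r = begin
    8 * (t r * walkSum r r 0 0) + t r * (2 * 4 ^ r)
      ≡⟨ regroup (t r) (walkSum r r 0 0) (4 ^ r) ⟩
    t r * (4 * (2 * walkSum r r 0 0)) + t r * (2 * 4 ^ r)
      ≡⟨ cong (λ z → t r * (4 * z) + t r * (2 * 4 ^ r)) (walkSum-balanced r) ⟩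
    t r * (4 * (r * 4 ^ r)) + t r * (2 * 4 ^ r)
      ≡⟨ collect (binom (suc M) (suc (double r))) (binom (M ∸ double r) (s ∸ r)) r (4 ^ r) ⟩
    2 * (suc (r + r) * binom (suc M) (suc (double r))) * binom (M ∸ double r) (s ∸ r) * 4 ^ r
      ≡⟨ cong (λ z → 2 * (suc z * binom (suc M) (suc (double r))) * binom (M ∸ double r) (s ∸ r) * 4 ^ r) (sym (double≡+ r)) ⟩
    2 * (suc (double r) * binom (suc M) (suc (double r))) * binom (M ∸ double r) (s ∸ r) * 4 ^ r
      ≡⟨ cong (λ z → 2 * z * binom (M ∸ double r) (s ∸ r) * 4 ^ r) (binom-absorb M (double r)) ⟩
    2 * (suc M * binom M (double r)) * binom (M ∸ double r) (s ∸ r) * 4 ^ r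
      ≡⟨ reassoc (suc M) (binom M (double r)) (binom (M ∸ double r) (s ∸ r)) (4 ^ r) ⟩
    2 * suc M * (trinom M (double r) (s ∸ r) * 4 ^ r) ∎
    where
    regroup : ∀ a b x → 8 * (a * b) + a * (2 * x) ≡ a * (4 * (2 * b)) + a * (2 * x)
    regroup = solve-∀
    collect : ∀ a b r x → a * b * (4 * (r * x)) + a * b * (2 * x) ≡ 2 * (suc (r + r) * a) * b * x
    collect = solve-∀
    reassoc : ∀ c a b x → 2 * (c * a) * b * x ≡ 2 * c * (a * b * x)
    reassoc = solve-∀

double≡2* : ∀ r → double r ≡ 2 * r
double≡2* zero    = refl
double≡2* (suc r) = trans (cong (λ x → suc (suc x)) (double≡2* r)) (step r)
  where
  step : ∀ r → suc (suc (2 * r)) ≡ 2 * suc r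
  step = solve-∀

emdFormula-binom : ∀ s m → 8 * emdFormula s m + binom (2 * s + 2 * suc m) (2 * s + 1) ≡ 2 * suc (s + m) * binom (2 * (s + m)) (2 * s)
emdFormula-binom s m = begin
  8 * emdFormula s m + binom (2 * s + 2 * suc m) (2 * s + 1)
    ≡⟨ cong (8 * emdFormula s m +_) (sym (cong₂ binom (trans (double≡2* (suc M)) (distrib s m))
                                                      (trans (cong suc (double≡2* s)) (+-comm 1 (2 * s))))) ⟩
  8 * emdFormula s m + binom (double (suc M)) (suc (double s))
    ≡⟨ cong (8 * emdFormula s m +_) (sym (oddSum≡binom (suc M) s)) ⟩
  8 * emdFormula s m + oddSum (suc M) s
    ≡⟨ emdFormula-recombine s m ⟩
  2 * suc M * evenSum M s
    ≡⟨ cong (2 * suc M *_) (trans (evenSum≡binom M s) (cong₂ binom (double≡2* M) (double≡2* s))) ⟩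
  2 * suc M * binom (2 * M) (2 * s) ∎
  where
  M = s + m
  distrib : ∀ s m → 2 * suc (s + m) ≡ 2 * s + 2 * suc m
  distrib = solve-∀

emdFormula-closed : ∀ s m → emdFormula s m * (4 * s + 4 * suc m ∸ 2) ≡ s * m * binom (2 * s + 2 * suc m) (2 * s + 1)
emdFormula-closed s m = *-cancelˡ-≡ _ _ 4 (+-cancelʳ-≡ (B₁ * k) _ _ (begin
  4 * (T * (4 * s + 4 * suc m ∸ 2)) + B₁ * k ≡⟨ cong (λ z → 4 * (T * z) + B₁ * k) width ⟩
  4 * (T * (2 * k)) + B₁ * k                 ≡⟨ factor T B₁ k ⟩
  (8 * T + B₁) * k                           ≡⟨ cong (_* k) (emdFormula-binom s m) ⟩
  2 * suc M * B₀ * k                         ≡⟨ reorder M B₀ ⟩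
  suc (suc (2 * M)) * k * B₀                 ≡⟨ sym ratio ⟩
  suc (2 * s) * suc (2 * m) * B₁             ≡⟨ expand s m B₁ ⟩
  4 * (s * m * B₁) + B₁ * k                  ∎))
  where
  M = s + m
  T = emdFormula s m
  k = suc (2 * M)
  B₀ = binom (2 * M) (2 * s)
  B₁ = binom (2 * s + 2 * suc m) (2 * s + 1)
  width : 4 * s + 4 * suc m ∸ 2 ≡ 2 * k
  width = trans (cong (_∸ 2) (spread s m)) (m+n∸m≡n 2 (2 * k))
    where
    spread : ∀ s m → 4 * s + 4 * suc m ≡ 2 + 2 * suc (2 * (s + m))
    spread = solve-∀
  ratio : suc (2 * s) * suc (2 * m) * B₁ ≡ suc (suc (2 * M)) * k * B₀
  ratio = begin
    suc (2 * s) * suc (2 * m) * B₁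
      ≡⟨ cong (suc (2 * s) * suc (2 * m) *_) (cong₂ binom (shift s m) (+-comm (2 * s) 1)) ⟩
    suc (2 * s) * suc (2 * m) * binom (suc (suc (2 * s + 2 * m))) (suc (2 * s))
      ≡⟨ binom-ratio (2 * s) (2 * m) ⟩
    suc (suc (2 * s + 2 * m)) * suc (2 * s + 2 * m) * binom (2 * s + 2 * m) (2 * s)
      ≡⟨ cong (λ z → suc (suc z) * suc z * binom z (2 * s)) (sym (*-distribˡ-+ 2 s m)) ⟩
    suc (suc (2 * M)) * k * B₀ ∎
    where
    shift : ∀ s m → 2 * s + 2 * suc m ≡ suc (suc (2 * s + 2 * m))
    shift = solve-∀
  factor : ∀ t b k → 4 * (t * (2 * k)) + b * k ≡ (8 * t + b) * k
  factor = solve-∀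
  reorder : ∀ M b → 2 * suc M * b * suc (2 * M) ≡ suc (suc (2 * M)) * suc (2 * M) * b
  reorder = solve-∀
  expand : ∀ s m b → suc (2 * s) * suc (2 * m) * b ≡ 4 * (s * m * b) + b * suc (2 * (s + m))
  expand = solve-∀

-- Compositions as words

sumOver : {A : Set} → List A → (A → ℕ) → ℕ
sumOver []       f = 0
sumOver (x ∷ xs) f = f x + sumOver xs f

sum≡sumOver : (xs : List ℕ) → sum xs ≡ sumOver xs id
sum≡sumOver []       = refl
sum≡sumOver (x ∷ xs) = cong (x +_) (sum≡sumOver xs)

sumOver-++ : {A : Set} (xs ys : List A) (f : A → ℕ) → sumOver (xs ++ ys) f ≡ sumOver xs f + sumOver ys f
sumOver-++ []       ys f = refl
sumOver-++ (x ∷ xs) ys f = trans (cong (f x +_) (sumOver-++ xs ys f)) (sym (+-assoc (f x) _ _))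

sumOver-map : {A B : Set} (g : A → B) (xs : List A) (f : B → ℕ) → sumOver (map g xs) f ≡ sumOver xs (f ∘ g)
sumOver-map g []       f = refl
sumOver-map g (x ∷ xs) f = cong (f (g x) +_) (sumOver-map g xs f)

sumOver-concatMap : {A B : Set} (g : A → List B) (xs : List A) (f : B → ℕ) →
  sumOver (concatMap g xs) f ≡ sumOver xs (λ x → sumOver (g x) f)
sumOver-concatMap g []       f = refl
sumOver-concatMap g (x ∷ xs) f =
  trans (sumOver-++ (g x) (concatMap g xs) f) (cong (sumOver (g x) f +_) (sumOver-concatMap g xs f))

sumOver-cong : {A : Set} (xs : List A) {f g : A → ℕ} → (∀ x → f x ≡ g x) → sumOver xs f ≡ sumOver xs g
sumOver-cong []       eq = refl
sumOver-cong (x ∷ xs) eq = cong₂ _+_ (eq x) (sumOver-cong xs eq)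

sumOver-+ : {A : Set} (xs : List A) (f g : A → ℕ) → sumOver xs (λ x → f x + g x) ≡ sumOver xs f + sumOver xs g
sumOver-+ []       f g = refl
sumOver-+ (x ∷ xs) f g rewrite sumOver-+ xs f g = +-+-comm (f x) (g x) (sumOver xs f) (sumOver xs g)
  where
  +-+-comm : ∀ a b c d → a + b + (c + d) ≡ a + c + (b + d)
  +-+-comm = solve-∀

sumOver-*ˡ : {A : Set} (xs : List A) (c : ℕ) (f : A → ℕ) → sumOver xs (λ x → c * f x) ≡ c * sumOver xs f
sumOver-*ˡ []       c f = sym (*-zeroʳ c)
sumOver-*ˡ (x ∷ xs) c f rewrite sumOver-*ˡ xs c f = sym (*-distribˡ-+ c (f x) (sumOver xs f))

sumOver-zero : {A : Set} (xs : List A) (f : A → ℕ) → (∀ x → f x ≡ 0) → sumOver xs f ≡ 0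
sumOver-zero []       f eq = refl
sumOver-zero (x ∷ xs) f eq rewrite eq x = sumOver-zero xs f eq

sumOver-Σ< : {A : Set} (xs : List A) (n : ℕ) (f : A → ℕ → ℕ) →
  sumOver xs (λ x → Σ< n (f x)) ≡ Σ< n (λ i → sumOver xs (λ x → f x i))
sumOver-Σ< []       n f = sym (Σ<-zero n _ (λ _ _ → refl))
sumOver-Σ< (x ∷ xs) n f rewrite sumOver-Σ< xs n f = sym (Σ<-+ n (f x) (λ i → sumOver xs (λ x → f x i)))

-- A composition (a₁, …, aₙ) is read as the word ⋆^a₁ | ⋆^a₂ | ⋯ | ⋆^aₙ with s stars and n - 1 bars:
-- 0 ∷ v is a bar followed by the word of v, and addStar v is a star followed by it.
addStar : ∀ {n} → Vec ℕ (suc n) → Vec ℕ (suc n)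
addStar (a ∷ v) = suc a ∷ v

starTails : ℕ → (m : ℕ) → List (Vec ℕ (suc m))
starTails zero    m = []
starTails (suc s) m = compositions s (suc m)

compositions-suc : ∀ s m → compositions s (suc m) ≡ concatMap (λ a → map (a ∷_) (compositions (s ∸ a) m)) (upTo (suc s))
compositions-suc zero    m = refl
compositions-suc (suc s) m = refl

compositions-split : ∀ s m → compositions s (suc m) ≡ map (0 ∷_) (compositions s m) ++ map addStar (starTails s m)
compositions-split zero    m = refl
compositions-split (suc s) m = cong (map (0 ∷_) (compositions (suc s) m) ++_) (begin
  concatMap F (applyUpTo suc (suc s))
    ≡⟨ cong (concatMap F) (sym (map-applyUpTo id suc (suc s))) ⟩
  concatMap F (map suc (upTo (suc s)))
    ≡⟨ concatMap-map F suc (upTo (suc s)) ⟩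
  concatMap (λ a → map (suc a ∷_) (compositions (s ∸ a) m)) (upTo (suc s))
    ≡⟨ concatMap-cong (λ a → map-∘ (compositions (s ∸ a) m)) (upTo (suc s)) ⟩
  concatMap (λ a → map addStar (map (a ∷_) (compositions (s ∸ a) m))) (upTo (suc s))
    ≡⟨ sym (map-concatMap addStar (λ a → map (a ∷_) (compositions (s ∸ a) m)) (upTo (suc s))) ⟩
  map addStar (concatMap (λ a → map (a ∷_) (compositions (s ∸ a) m)) (upTo (suc s)))
    ≡⟨ cong (map addStar) (sym (compositions-suc s m)) ⟩
  map addStar (compositions s (suc m)) ∎)
  where
  F : ℕ → List (Vec ℕ (suc m))
  F a = map (a ∷_) (compositions (suc s ∸ a) m)

sumOver-compositions : ∀ s m (f : Vec ℕ (suc m) → ℕ) →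
  sumOver (compositions s (suc m)) f ≡ sumOver (compositions s m) (λ v → f (0 ∷ v)) + sumOver (starTails s m) (λ v → f (addStar v))
sumOver-compositions s m f = begin
  sumOver (compositions s (suc m)) f
    ≡⟨ cong (λ l → sumOver l f) (compositions-split s m) ⟩
  sumOver (map (0 ∷_) (compositions s m) ++ map addStar (starTails s m)) f
    ≡⟨ sumOver-++ (map (0 ∷_) (compositions s m)) (map addStar (starTails s m)) f ⟩
  sumOver (map (0 ∷_) (compositions s m)) f + sumOver (map addStar (starTails s m)) f
    ≡⟨ cong₂ _+_ (sumOver-map (0 ∷_) (compositions s m) f) (sumOver-map addStar (starTails s m) f) ⟩
  sumOver (compositions s m) (λ v → f (0 ∷ v)) + sumOver (starTails s m) (λ v → f (addStar v)) ∎

length-compositions : ∀ s m → length (compositions s (suc m)) ≡ binom (s + m) s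
length-compositions zero    zero    = refl
length-compositions (suc s) zero    = begin
  length (compositions (suc s) 1)     ≡⟨ cong length (compositions-split (suc s) 0) ⟩
  length (map addStar (compositions s 1)) ≡⟨ length-map addStar (compositions s 1) ⟩
  length (compositions s 1)           ≡⟨ length-compositions s zero ⟩
  binom (s + 0) s                     ≡⟨ trans (cong (λ z → binom z s) (+-identityʳ s)) (binom[n,n]≡1 s) ⟩
  1                                   ≡⟨ sym (trans (cong (λ z → binom z (suc s)) (+-identityʳ (suc s))) (binom[n,n]≡1 (suc s))) ⟩
  binom (suc s + 0) (suc s)           ∎
length-compositions zero    (suc m) = begin
  length (compositions 0 (suc (suc m))) ≡⟨ cong length (compositions-split 0 (suc m)) ⟩
  length (map (0 ∷_) (compositions 0 (suc m)) ++ []) ≡⟨ cong length (++-identityʳ (map (0 ∷_) (compositions 0 (suc m)))) ⟩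
  length (map (0 ∷_) (compositions 0 (suc m))) ≡⟨ length-map (0 ∷_) (compositions 0 (suc m)) ⟩
  length (compositions 0 (suc m))       ≡⟨ length-compositions zero m ⟩
  binom m 0                             ≡⟨ binom[n,0]≡1 m ⟩
  1                                     ∎
length-compositions (suc s) (suc m) = begin
  length (compositions (suc s) (suc (suc m)))
    ≡⟨ cong length (compositions-split (suc s) (suc m)) ⟩
  length (map (0 ∷_) (compositions (suc s) (suc m)) ++ map addStar (compositions s (suc (suc m))))
    ≡⟨ length-++ (map (0 ∷_) (compositions (suc s) (suc m))) ⟩
  length (map (0 ∷_) (compositions (suc s) (suc m))) + length (map addStar (compositions s (suc (suc m))))
    ≡⟨ cong₂ _+_ (length-map (0 ∷_) (compositions (suc s) (suc m))) (length-map addStar (compositions s (suc (suc m)))) ⟩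
  length (compositions (suc s) (suc m)) + length (compositions s (suc (suc m)))
    ≡⟨ cong₂ _+_ (length-compositions (suc s) m) (length-compositions s (suc m)) ⟩
  binom (suc s + m) (suc s) + binom (s + suc m) s
    ≡⟨ cong (λ z → binom z (suc s) + binom (s + suc m) s) (sym (+-suc s m)) ⟩
  binom (s + suc m) (suc s) + binom (s + suc m) s
    ≡⟨ +-comm (binom (s + suc m) (suc s)) _ ⟩
  binom (suc (s + suc m)) (suc s) ∎

-- The earth mover's distance through star counts

starsIn : ∀ {n} → ℕ → Vec ℕ n → ℕ
starsIn zero    _                = 0
starsIn (suc L) []               = 0
starsIn (suc L) (suc a ∷ v)      = suc (starsIn L (a ∷ v))
starsIn (suc L) (zero ∷ [])      = 0
starsIn (suc L) (zero ∷ (b ∷ v)) = starsIn L (b ∷ v)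

starsIn-bar : ∀ {n} L (v : Vec ℕ n) → starsIn (suc L) (0 ∷ v) ≡ starsIn L v
starsIn-bar zero    []      = refl
starsIn-bar (suc L) []      = refl
starsIn-bar L       (b ∷ v) = refl

starsIn-addStar : ∀ {n} L (v : Vec ℕ (suc n)) → starsIn (suc L) (addStar v) ≡ suc (starsIn L v)
starsIn-addStar L (a ∷ v) = refl

starsIn≤length : ∀ {n} L (v : Vec ℕ n) → starsIn L v ≤ L
starsIn≤length zero    v                = z≤n
starsIn≤length (suc L) []               = z≤n
starsIn≤length (suc L) (suc a ∷ v)      = s≤s (starsIn≤length L (a ∷ v))
starsIn≤length (suc L) (zero ∷ [])      = z≤n
starsIn≤length (suc L) (zero ∷ (b ∷ v)) = m≤n⇒m≤1+n (starsIn≤length L (b ∷ v))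

starsIn≤sum : ∀ {n} L (v : Vec ℕ n) → starsIn L v ≤ sumᵥ v
starsIn≤sum zero    v                = z≤n
starsIn≤sum (suc L) []               = z≤n
starsIn≤sum (suc L) (suc a ∷ v)      = s≤s (starsIn≤sum L (a ∷ v))
starsIn≤sum (suc L) (zero ∷ [])      = z≤n
starsIn≤sum (suc L) (zero ∷ (b ∷ v)) = starsIn≤sum L (b ∷ v)

starsIn-mono : ∀ {n} L (v : Vec ℕ n) → starsIn L v ≤ starsIn (suc L) v
starsIn-mono zero    v                = z≤n
starsIn-mono (suc L) []               = z≤n
starsIn-mono (suc L) (suc a ∷ v)      = s≤s (starsIn-mono L (a ∷ v))
starsIn-mono (suc L) (zero ∷ [])      = z≤n
starsIn-mono (suc L) (zero ∷ (b ∷ v)) = starsIn-mono L (b ∷ v)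

starsIn-suc≤ : ∀ {n} L (v : Vec ℕ n) → starsIn (suc L) v ≤ suc (starsIn L v)
starsIn-suc≤ zero    []               = z≤n
starsIn-suc≤ zero    (suc a ∷ v)      = s≤s z≤n
starsIn-suc≤ zero    (zero ∷ [])      = z≤n
starsIn-suc≤ zero    (zero ∷ (b ∷ v)) = z≤n
starsIn-suc≤ (suc L) []               = z≤n
starsIn-suc≤ (suc L) (suc a ∷ v)      = s≤s (starsIn-suc≤ L (a ∷ v))
starsIn-suc≤ (suc L) (zero ∷ [])      = z≤n
starsIn-suc≤ (suc L) (zero ∷ (b ∷ v)) = starsIn-suc≤ L (b ∷ v)

starsIn-bars : ∀ {m} L (v : Vec ℕ (suc m)) → L ≤ sumᵥ v + m → L ≤ starsIn L v + m
starsIn-bars zero v _ = z≤n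
starsIn-bars (suc L) (suc a ∷ v) le = s≤s (starsIn-bars L (a ∷ v) (s≤s⁻¹ le))
starsIn-bars {zero}  (suc L) (zero ∷ [])      ()
starsIn-bars {suc m} (suc L) (zero ∷ (b ∷ v)) le =
  subst (suc L ≤_) (sym (+-suc (starsIn L (b ∷ v)) m))
        (s≤s (starsIn-bars L (b ∷ v) (s≤s⁻¹ (subst (suc L ≤_) (+-suc (sumᵥ (b ∷ v)) m) le))))

starsIn-all : ∀ {m} (v : Vec ℕ (suc m)) → starsIn (sumᵥ v + m) v ≡ sumᵥ v
starsIn-all {m} v = ≤-antisym (starsIn≤sum (sumᵥ v + m) v)
                              (+-cancelʳ-≤ m (sumᵥ v) _ (starsIn-bars (sumᵥ v + m) v ≤-refl))

starsIn-past : ∀ {k} L a (v : Vec ℕ (suc k)) → starsIn (suc a + L) (a ∷ v) ≡ a + starsIn L v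
starsIn-past L zero    (b ∷ v) = refl
starsIn-past L (suc a) v       = cong suc (starsIn-past L a v)

prefix : ∀ {n} → ℕ → Vec ℕ n → ℕ
prefix zero    v       = 0
prefix (suc i) []      = 0
prefix (suc i) (a ∷ v) = a + prefix i v

prefixSum≡prefix : ∀ {n} i (v : Vec ℕ n) → prefixSum i v ≡ prefix i v
prefixSum≡prefix zero    v       = refl
prefixSum≡prefix (suc i) []      = refl
prefixSum≡prefix (suc i) (a ∷ v) = cong (a +_) (prefixSum≡prefix i v)

prefix≤sum : ∀ {n} i (v : Vec ℕ n) → prefix i v ≤ sumᵥ v
prefix≤sum zero    v       = z≤n
prefix≤sum (suc i) []      = z≤n
prefix≤sum (suc i) (a ∷ v) = +-monoʳ-≤ a (prefix≤sum i v)

starsIn-cons-⊓ : ∀ {n} L a (v : Vec ℕ n) → L ⊓ a ≤ starsIn L (a ∷ v)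
starsIn-cons-⊓ zero    a       v = z≤n
starsIn-cons-⊓ (suc L) zero    v = z≤n
starsIn-cons-⊓ (suc L) (suc a) v = s≤s (starsIn-cons-⊓ L a v)

starsIn-shift : ∀ {k} i a k′ (v : Vec ℕ (suc k)) → starsIn (suc i + (a + k′)) (a ∷ v) ≡ a + starsIn (i + k′) v
starsIn-shift i a k′ v = trans (cong (λ L → starsIn L (a ∷ v)) (reindex i a k′)) (starsIn-past (i + k′) a v)
  where
  reindex : ∀ i a k′ → suc i + (a + k′) ≡ suc a + (i + k′)
  reindex = solve-∀

-- Both inequalities say that the (i + 1)-st bar lies among the first i + 1 + k letters.
prefix≤⇒starsIn≤ : ∀ {m} (α : Vec ℕ (suc m)) i k → i < m → prefix (suc i) α ≤ k → starsIn (suc i + k) α ≤ k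
prefix≤⇒starsIn≤ {suc m} (a ∷ v) i k i<m le with m≤n⇒∃[o]m+o≡n (≤-trans (m≤m+n a (prefix i v)) le)
... | k′ , refl = subst (_≤ a + k′) (sym (starsIn-shift i a k′ v)) (+-monoʳ-≤ a (rest i i<m (+-cancelˡ-≤ a _ _ le)))
  where
  rest : ∀ i → i < suc m → prefix i v ≤ k′ → starsIn (i + k′) v ≤ k′
  rest zero     _   _ = starsIn≤length k′ v
  rest (suc i′) i<m h = prefix≤⇒starsIn≤ v i′ k′ (s≤s⁻¹ i<m) h

starsIn≤⇒prefix≤ : ∀ {m} (α : Vec ℕ (suc m)) i k → i < m → starsIn (suc i + k) α ≤ k → prefix (suc i) α ≤ k
starsIn≤⇒prefix≤ {suc m} (a ∷ v) i k i<m le with a ≤? k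
... | no a≰k = contradiction (≤-trans (⊓-glb (m<n+m k z<s) (≰⇒> a≰k)) (starsIn-cons-⊓ (suc i + k) a v)) (<⇒≱ (s≤s le))
... | yes a≤k with m≤n⇒∃[o]m+o≡n a≤k
...   | k′ , refl = +-monoʳ-≤ a (rest i i<m (+-cancelˡ-≤ a _ _ (subst (_≤ a + k′) (starsIn-shift i a k′ v) le)))
  where
  rest : ∀ i → i < suc m → starsIn (i + k′) v ≤ k′ → prefix i v ≤ k′
  rest zero     _   _ = z≤n
  rest (suc i′) i<m h = starsIn≤⇒prefix≤ v i′ k′ (s≤s⁻¹ i<m) h

𝟙[_≤_] : ℕ → ℕ → ℕ
𝟙[ a ≤ k ] with a ≤? k
... | yes _ = 1
... | no  _ = 0

𝟙-yes : ∀ {a k} → a ≤ k → 𝟙[ a ≤ k ] ≡ 1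
𝟙-yes {a} {k} a≤k with a ≤? k
... | yes _   = refl
... | no  a≰k = contradiction a≤k a≰k

𝟙-no : ∀ {a k} → k < a → 𝟙[ a ≤ k ] ≡ 0
𝟙-no {a} {k} k<a with a ≤? k
... | yes a≤k = contradiction a≤k (<⇒≱ k<a)
... | no  _   = refl

𝟙-cong : ∀ {a b k} → (a ≤ k → b ≤ k) → (b ≤ k → a ≤ k) → 𝟙[ a ≤ k ] ≡ 𝟙[ b ≤ k ]
𝟙-cong {a} {b} {k} to from with a ≤? k | b ≤? k
... | yes _   | yes _   = refl
... | no  _   | no  _   = refl
... | yes a≤k | no  b≰k = contradiction (to a≤k) b≰k
... | no  a≰k | yes b≤k = contradiction (from b≤k) a≰k

Σ<-𝟙 : ∀ s a → Σ< s (λ k → 𝟙[ a ≤ k ]) ≡ s ∸ a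
Σ<-𝟙 zero    a = sym (0∸n≡0 a)
Σ<-𝟙 (suc s) a = last (a ≤? s)
  where
  last : Dec (a ≤ s) → Σ< s (λ k → 𝟙[ a ≤ k ]) + 𝟙[ a ≤ s ] ≡ suc s ∸ a
  last (yes a≤s) = begin
    Σ< s (λ k → 𝟙[ a ≤ k ]) + 𝟙[ a ≤ s ] ≡⟨ cong₂ _+_ (Σ<-𝟙 s a) (𝟙-yes a≤s) ⟩
    s ∸ a + 1                           ≡⟨ +-comm (s ∸ a) 1 ⟩
    suc (s ∸ a)                         ≡⟨ sym (+-∸-assoc 1 a≤s) ⟩
    suc s ∸ a                           ∎
  last (no a≰s) = begin
    Σ< s (λ k → 𝟙[ a ≤ k ]) + 𝟙[ a ≤ s ] ≡⟨ cong₂ _+_ (Σ<-𝟙 s a) (𝟙-no (≰⇒> a≰s)) ⟩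
    s ∸ a + 0                           ≡⟨ +-identityʳ _ ⟩
    s ∸ a                               ≡⟨ m≤n⇒m∸n≡0 (<⇒≤ (≰⇒> a≰s)) ⟩
    0                                   ≡⟨ sym (m≤n⇒m∸n≡0 (≰⇒> a≰s)) ⟩
    suc s ∸ a                           ∎

∣a-b∣≡Σ<∣𝟙-𝟙∣-≤ : ∀ s a b → a ≤ b → b ≤ s → ∣ a - b ∣ ≡ Σ< s (λ k → ∣ 𝟙[ a ≤ k ] - 𝟙[ b ≤ k ] ∣)
∣a-b∣≡Σ<∣𝟙-𝟙∣-≤ s a b a≤b b≤s = begin
  ∣ a - b ∣                                          ≡⟨ m≤n⇒∣m-n∣≡n∸m a≤b ⟩
  b ∸ a                                              ≡⟨ sym difference ⟩
  (s ∸ a) ∸ (s ∸ b)                                  ≡⟨ cong₂ _∸_ (sym (Σ<-𝟙 s a)) (sym (Σ<-𝟙 s b)) ⟩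
  Σ< s (λ k → 𝟙[ a ≤ k ]) ∸ Σ< s (λ k → 𝟙[ b ≤ k ]) ≡⟨ sym (Σ<-∸ s _ _ pointwise) ⟩
  Σ< s (λ k → 𝟙[ a ≤ k ] ∸ 𝟙[ b ≤ k ])              ≡⟨ Σ<-cong′ s term ⟩
  Σ< s (λ k → ∣ 𝟙[ a ≤ k ] - 𝟙[ b ≤ k ] ∣)          ∎
  where
  pointwise : ∀ k → k < s → 𝟙[ b ≤ k ] ≤ 𝟙[ a ≤ k ]
  pointwise k _ with b ≤? k
  ... | yes b≤k = ≤-reflexive (sym (𝟙-yes (≤-trans a≤b b≤k)))
  ... | no  _   = z≤n
  term : ∀ k → 𝟙[ a ≤ k ] ∸ 𝟙[ b ≤ k ] ≡ ∣ 𝟙[ a ≤ k ] - 𝟙[ b ≤ k ] ∣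
  term k with b ≤? k
  ... | yes b≤k rewrite 𝟙-yes (≤-trans a≤b b≤k) = refl
  ... | no  _ with a ≤? k
  ...   | yes _ = refl
  ...   | no  _ = refl
  difference : (s ∸ a) ∸ (s ∸ b) ≡ b ∸ a
  difference with m≤n⇒∃[o]m+o≡n b≤s
  ... | t , refl = begin
    (b + t) ∸ a ∸ ((b + t) ∸ b) ≡⟨ cong₂ _∸_ (+-∸-comm t a≤b) (m+n∸m≡n b t) ⟩
    (b ∸ a + t) ∸ t             ≡⟨ m+n∸n≡m (b ∸ a) t ⟩
    b ∸ a                       ∎

∣a-b∣≡Σ<∣𝟙-𝟙∣ : ∀ s a b → a ≤ s → b ≤ s → ∣ a - b ∣ ≡ Σ< s (λ k → ∣ 𝟙[ a ≤ k ] - 𝟙[ b ≤ k ] ∣)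
∣a-b∣≡Σ<∣𝟙-𝟙∣ s a b a≤s b≤s with ≤-total a b
... | inj₁ a≤b = ∣a-b∣≡Σ<∣𝟙-𝟙∣-≤ s a b a≤b b≤s
... | inj₂ b≤a = begin
  ∣ a - b ∣                                 ≡⟨ ∣-∣-comm a b ⟩
  ∣ b - a ∣                                 ≡⟨ ∣a-b∣≡Σ<∣𝟙-𝟙∣-≤ s b a b≤a a≤s ⟩
  Σ< s (λ k → ∣ 𝟙[ b ≤ k ] - 𝟙[ a ≤ k ] ∣) ≡⟨ Σ<-cong′ s (λ k → ∣-∣-comm 𝟙[ b ≤ k ] 𝟙[ a ≤ k ]) ⟩
  Σ< s (λ k → ∣ 𝟙[ a ≤ k ] - 𝟙[ b ≤ k ] ∣) ∎

∣m⊖n∣≡∣m-n∣ : ∀ m n → ℤ.∣ m ℤ.⊖ n ∣ ≡ ∣ m - n ∣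
∣m⊖n∣≡∣m-n∣ m n with ≤-total m n
... | inj₁ m≤n = trans (ℤ.∣⊖∣-≤ m≤n) (sym (m≤n⇒∣m-n∣≡n∸m m≤n))
... | inj₂ n≤m = trans (ℤ.∣m⊖n∣≡∣n⊖m∣ m n) (trans (ℤ.∣⊖∣-≤ n≤m) (sym (m≤n⇒∣n-m∣≡n∸m n≤m)))

sumOver-upTo : ∀ n (f : ℕ → ℕ) → sumOver (upTo n) f ≡ Σ< n f
sumOver-upTo n f = go n id
  where
  go : ∀ n (g : ℕ → ℕ) → sumOver (applyUpTo g n) f ≡ Σ< n (f ∘ g)
  go zero    g = refl
  go (suc n) g = trans (cong (f (g 0) +_) (go n (g ∘ suc))) (sym (Σ<-head n (f ∘ g)))

EMD≡Σ<∣prefix-prefix∣ : ∀ {m} (α β : Vec ℕ (suc m)) → EMD α β ≡ Σ< m (λ i → ∣ prefix (suc i) α - prefix (suc i) β ∣)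
EMD≡Σ<∣prefix-prefix∣ {m} α β = begin
  EMD α β                               ≡⟨ sum≡sumOver (map d (map suc (upTo m))) ⟩
  sumOver (map d (map suc (upTo m))) id ≡⟨ sumOver-map d (map suc (upTo m)) id ⟩
  sumOver (map suc (upTo m)) d          ≡⟨ sumOver-map suc (upTo m) d ⟩
  sumOver (upTo m) (d ∘ suc)            ≡⟨ sumOver-upTo m (d ∘ suc) ⟩
  Σ< m (d ∘ suc)                        ≡⟨ Σ<-cong′ m (λ i → trans (∣m⊖n∣≡∣m-n∣ (prefixSum (suc i) α) (prefixSum (suc i) β)) (cong₂ ∣_-_∣ (prefixSum≡prefix (suc i) α) (prefixSum≡prefix (suc i) β))) ⟩
  Σ< m (λ i → ∣ prefix (suc i) α - prefix (suc i) β ∣) ∎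
  where
  d : ℕ → ℕ
  d i = ℤ.∣ prefixSum i α ℤ.⊖ prefixSum i β ∣

Σ<-window : ∀ k m r (f : ℕ → ℕ) → (∀ L → L ≤ k → f L ≡ 0) → (∀ i → i < r → f (suc k + (m + i)) ≡ 0) →
  Σ< m (λ i → f (suc k + i)) ≡ Σ< (suc k + (m + r)) f
Σ<-window k m r f low high = sym (begin
  Σ< (suc k + (m + r)) f
    ≡⟨ Σ<-split (suc k) (m + r) f ⟩
  Σ< (suc k) f + Σ< (m + r) (λ i → f (suc k + i))
    ≡⟨ cong₂ _+_ (Σ<-zero (suc k) f (λ L L≤k → low L (s≤s⁻¹ L≤k))) (Σ<-split m r (λ i → f (suc k + i))) ⟩
  0 + (Σ< m (λ i → f (suc k + i)) + Σ< r (λ i → f (suc k + (m + i))))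
    ≡⟨ cong (Σ< m (λ i → f (suc k + i)) +_) (Σ<-zero r _ high) ⟩
  Σ< m (λ i → f (suc k + i)) + 0
    ≡⟨ +-identityʳ _ ⟩
  Σ< m (λ i → f (suc k + i)) ∎)

EMD≡Σ<∣starsIn-starsIn∣ : ∀ s m (α β : Vec ℕ (suc m)) → sumᵥ α ≡ s → sumᵥ β ≡ s →
  EMD α β ≡ Σ< (s + m) (λ L → ∣ starsIn L α - starsIn L β ∣)
EMD≡Σ<∣starsIn-starsIn∣ s m α β Σα Σβ = begin
  EMD α β
    ≡⟨ EMD≡Σ<∣prefix-prefix∣ α β ⟩
  Σ< m (λ i → ∣ prefix (suc i) α - prefix (suc i) β ∣)
    ≡⟨ Σ<-cong′ m (λ i → ∣a-b∣≡Σ<∣𝟙-𝟙∣ s _ _ (bounded (prefix≤sum (suc i) α) Σα) (bounded (prefix≤sum (suc i) β) Σβ)) ⟩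
  Σ< m (λ i → Σ< s (λ k → ∣ 𝟙[ prefix (suc i) α ≤ k ] - 𝟙[ prefix (suc i) β ≤ k ] ∣))
    ≡⟨ Σ<-cong m (λ i i<m → Σ<-cong′ s (λ k → cong₂ ∣_-_∣ (transpose α i k i<m) (transpose β i k i<m))) ⟩
  Σ< m (λ i → Σ< s (λ k → g (suc i + k) k))
    ≡⟨ Σ<-comm m s _ ⟩
  Σ< s (λ k → Σ< m (λ i → g (suc i + k) k))
    ≡⟨ Σ<-cong s (λ k k<s → trans (Σ<-cong′ m (λ i → cong (λ L → g (suc L) k) (+-comm i k)))
                                   (trans (Σ<-window k m (s ∸ suc k) (λ L → g L k) (low k) (high k k<s))
                                          (cong (λ n → Σ< n (λ L → g L k)) (total k<s)))) ⟩
  Σ< s (λ k → Σ< (s + m) (λ L → g L k))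
    ≡⟨ Σ<-comm s (s + m) _ ⟩
  Σ< (s + m) (λ L → Σ< s (λ k → g L k))
    ≡⟨ Σ<-cong′ (s + m) (λ L → sym (∣a-b∣≡Σ<∣𝟙-𝟙∣ s _ _ (bounded (starsIn≤sum L α) Σα) (bounded (starsIn≤sum L β) Σβ))) ⟩
  Σ< (s + m) (λ L → ∣ starsIn L α - starsIn L β ∣) ∎
  where
  g : ℕ → ℕ → ℕ
  g L k = ∣ 𝟙[ starsIn L α ≤ k ] - 𝟙[ starsIn L β ≤ k ] ∣
  bounded : ∀ {x y} → x ≤ y → y ≡ s → x ≤ s
  bounded x≤y refl = x≤y
  transpose : ∀ (γ : Vec ℕ (suc m)) i k → i < m → 𝟙[ prefix (suc i) γ ≤ k ] ≡ 𝟙[ starsIn (suc i + k) γ ≤ k ]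
  transpose γ i k i<m = 𝟙-cong (prefix≤⇒starsIn≤ γ i k i<m) (starsIn≤⇒prefix≤ γ i k i<m)
  total : ∀ {k} → k < s → suc k + (m + (s ∸ suc k)) ≡ s + m
  total {k} k<s = trans (rearrange (suc k) m (s ∸ suc k)) (cong (_+ m) (m+[n∸m]≡n k<s))
    where
    rearrange : ∀ a b c → a + (b + c) ≡ a + c + b
    rearrange = solve-∀
  low : ∀ k L → L ≤ k → g L k ≡ 0
  low k L L≤k rewrite 𝟙-yes (≤-trans (starsIn≤length L α) L≤k) | 𝟙-yes (≤-trans (starsIn≤length L β) L≤k) = refl
  beyond : ∀ (γ : Vec ℕ (suc m)) → sumᵥ γ ≡ s → ∀ k i → suc k + (m + i) ≤ s + m → k < starsIn (suc k + (m + i)) γ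
  beyond γ refl k i L≤ = +-cancelʳ-≤ m (suc k) _ (≤-trans (+-monoʳ-≤ (suc k) (m≤m+n m i)) (starsIn-bars _ γ L≤))
  inside : ∀ {k i} → k < s → i < s ∸ suc k → suc k + (m + i) ≤ s + m
  inside {k} k<s i<r = ≤-trans (+-monoʳ-≤ (suc k) (+-monoʳ-≤ m (<⇒≤ i<r))) (≤-reflexive (total k<s))
  high : ∀ k → k < s → ∀ i → i < s ∸ suc k → g (suc k + (m + i)) k ≡ 0
  high k k<s i i<r rewrite 𝟙-no (beyond α Σα k i (inside k<s i<r)) | 𝟙-no (beyond β Σβ k i (inside k<s i<r)) = refl

-- Classes of pairs of words

starAt : ∀ {n} → ℕ → Vec ℕ n → ℕ
starAt L v = starsIn (suc L) v ∸ starsIn L v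

-- Cons a α α′: the word of α is the letter a (1 for a star, 0 for a bar) followed by the word of α′.
record Cons {n k} (a : ℕ) (α : Vec ℕ n) (α′ : Vec ℕ k) : Set where
  constructor cons
  field starsIn-suc : ∀ L → starsIn (suc L) α ≡ a + starsIn L α′

cons-bar : ∀ {n} (v : Vec ℕ n) → Cons 0 (0 ∷ v) v
cons-bar v = cons (λ L → starsIn-bar L v)

cons-star : ∀ {n} (v : Vec ℕ (suc n)) → Cons 1 (addStar v) v
cons-star v = cons (λ L → starsIn-addStar L v)

module _ {n k a} {α : Vec ℕ n} {α′ : Vec ℕ k} (c : Cons a α α′) where
  open Cons c

  starAt-head : starAt 0 α ≡ a
  starAt-head = trans (starsIn-suc 0) (+-identityʳ a)

  starAt-tail : ∀ L → starAt (suc L) α ≡ starAt L α′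
  starAt-tail L = trans (cong₂ _∸_ (starsIn-suc (suc L)) (starsIn-suc L)) ([m+n]∸[m+o]≡n∸o a _ _)

pairCount : (ℕ → ℕ → ℕ) → ∀ {n₁ n₂} → Vec ℕ n₁ → Vec ℕ n₂ → ℕ → ℕ
pairCount h α β M = Σ< M (λ L → h (starAt L α) (starAt L β))

pairCount-cons : ∀ h {n₁ n₂ k₁ k₂ a b} {α : Vec ℕ n₁} {β : Vec ℕ n₂} {α′ : Vec ℕ k₁} {β′ : Vec ℕ k₂} M →
  Cons a α α′ → Cons b β β′ → pairCount h α β (suc M) ≡ h a b + pairCount h α′ β′ M
pairCount-cons h M cα cβ =
  trans (Σ<-head M _) (cong₂ _+_ (cong₂ h (starAt-head cα) (starAt-head cβ))
                                 (Σ<-cong′ M (λ L → cong₂ h (starAt-tail cα L) (starAt-tail cβ L))))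

starStar barBar starBar barStar : ℕ → ℕ → ℕ
starStar a b = a * b
barBar   a b = (1 ∸ a) * (1 ∸ b)
starBar  a b = a * (1 ∸ b)
barStar  a b = (1 ∸ a) * b

δ : ℕ → ℕ → ℕ
δ zero    zero    = 1
δ zero    (suc _) = 0
δ (suc _) zero    = 0
δ (suc x) (suc y) = δ x y

δ-refl : ∀ x → δ x x ≡ 1
δ-refl zero    = refl
δ-refl (suc x) = δ-refl x

δ-≢ : ∀ {x y} → x ≢ y → δ x y ≡ 0
δ-≢ {zero}  {zero}  x≢y = contradiction refl x≢y
δ-≢ {zero}  {suc y} x≢y = refl
δ-≢ {suc x} {zero}  x≢y = refl
δ-≢ {suc x} {suc y} x≢y = δ-≢ (x≢y ∘ cong suc)

Σ<-δ : ∀ n k → k < n → Σ< n (δ k) ≡ 1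
Σ<-δ (suc n) k k<1+n with k ≟ n
... | yes refl = trans (cong (_+ δ k k) (Σ<-zero n (δ k) (λ i i<k → δ-≢ (λ k≡i → <-irrefl (sym k≡i) i<k)))) (δ-refl k)
... | no  k≢n  = trans (cong₂ _+_ (Σ<-δ n k (≤∧≢⇒< (s≤s⁻¹ k<1+n) k≢n)) (δ-≢ k≢n)) (+-identityʳ 1)

inClass : ℕ → ℕ → ℕ → ℕ → ℕ → ∀ {n₁ n₂} → Vec ℕ n₁ → Vec ℕ n₂ → ℕ
inClass M p q u v α β =
  δ (pairCount starStar α β M) p * δ (pairCount barBar α β M) q * δ (pairCount starBar α β M) u * δ (pairCount barStar α β M) v

inClass-cons : ∀ M p q u v {n₁ n₂ k₁ k₂ a b} {α : Vec ℕ n₁} {β : Vec ℕ n₂} {α′ : Vec ℕ k₁} {β′ : Vec ℕ k₂} →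
  Cons a α α′ → Cons b β β′ →
  inClass (suc M) p q u v α β
    ≡ δ (starStar a b + pairCount starStar α′ β′ M) p * δ (barBar a b + pairCount barBar α′ β′ M) q
      * δ (starBar a b + pairCount starBar α′ β′ M) u * δ (barStar a b + pairCount barStar α′ β′ M) v
inClass-cons M p q u v {a = a} {b} {α} {β} {α′} {β′} cα cβ =
  cong₂ _*_ (cong₂ _*_ (cong₂ _*_ (count starStar p) (count barBar q)) (count starBar u)) (count barStar v)
  where
  count : ∀ h x → δ (pairCount h α β (suc M)) x ≡ δ (h a b + pairCount h α′ β′ M) x
  count h x = cong (λ c → δ c x) (pairCount-cons h M cα cβ)

offsetDistance : ℕ → ℕ → ℕ → ∀ {n₁ n₂} → Vec ℕ n₁ → Vec ℕ n₂ → ℕ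
offsetDistance d₁ d₂ M α β = Σ< M (λ L → ∣ d₁ + starsIn L α - d₂ + starsIn L β ∣)

offsetDistance-cons : ∀ d₁ d₂ M {n₁ n₂ k₁ k₂ a b} {α : Vec ℕ n₁} {β : Vec ℕ n₂} {α′ : Vec ℕ k₁} {β′ : Vec ℕ k₂} →
  Cons a α α′ → Cons b β β′ → offsetDistance d₁ d₂ (suc M) α β ≡ ∣ d₁ - d₂ ∣ + offsetDistance (a + d₁) (b + d₂) M α′ β′
offsetDistance-cons d₁ d₂ M {a = a} {b} {α′ = α′} {β′} (cons stα) (cons stβ) =
  trans (Σ<-head M _) (cong₂ _+_ (cong₂ ∣_-_∣ (+-identityʳ d₁) (+-identityʳ d₂))
                                 (Σ<-cong′ M (λ L → cong₂ ∣_-_∣ (shift d₁ a _ (stα L)) (shift d₂ b _ (stβ L)))))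
  where
  shift : ∀ d a y {x} → x ≡ a + y → d + x ≡ a + d + y
  shift d a y refl = trans (sym (+-assoc d a y)) (cong (_+ y) (+-comm d a))

sumOver² : {A B : Set} → List A → List B → (A → B → ℕ) → ℕ
sumOver² xs ys f = sumOver xs (λ x → sumOver ys (f x))

sumOver²-cong : {A B : Set} (xs : List A) (ys : List B) {f g : A → B → ℕ} →
  (∀ x y → f x y ≡ g x y) → sumOver² xs ys f ≡ sumOver² xs ys g
sumOver²-cong xs ys eq = sumOver-cong xs (λ x → sumOver-cong ys (eq x))

sumOver²-zero : {A B : Set} (xs : List A) (ys : List B) (f : A → B → ℕ) →
  (∀ x y → f x y ≡ 0) → sumOver² xs ys f ≡ 0
sumOver²-zero xs ys f eq = trans (sumOver-cong xs (λ x → sumOver-zero ys (f x) (eq x))) (sumOver-zero xs _ (λ _ → refl))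

sumOver²-peel : {A B : Set} (xs : List A) (ys : List B) (c W : A → B → ℕ) (w : ℕ) →
  sumOver² xs ys (λ x y → c x y * (w + W x y)) ≡ w * sumOver² xs ys (λ x y → c x y * 1) + sumOver² xs ys (λ x y → c x y * W x y)
sumOver²-peel xs ys c W w = begin
  sumOver² xs ys (λ x y → c x y * (w + W x y))
    ≡⟨ sumOver²-cong xs ys (λ x y → distrib (c x y) w (W x y)) ⟩
  sumOver² xs ys (λ x y → w * (c x y * 1) + c x y * W x y)
    ≡⟨ sumOver-cong xs (λ x → trans (sumOver-+ ys _ _) (cong (_+ _) (sumOver-*ˡ ys w _))) ⟩
  sumOver xs (λ x → w * sumOver ys (λ y → c x y * 1) + sumOver ys (λ y → c x y * W x y))
    ≡⟨ trans (sumOver-+ xs _ _) (cong (_+ _) (sumOver-*ˡ xs w _)) ⟩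
  w * sumOver² xs ys (λ x y → c x y * 1) + sumOver² xs ys (λ x y → c x y * W x y) ∎
  where
  distrib : ∀ c w b → c * (w + b) ≡ w * (c * 1) + c * b
  distrib = solve-∀

sumOver²-compositions : ∀ s₁ m₁ s₂ m₂ (f : Vec ℕ (suc m₁) → Vec ℕ (suc m₂) → ℕ) →
  sumOver² (compositions s₁ (suc m₁)) (compositions s₂ (suc m₂)) f
    ≡ sumOver² (compositions s₁ m₁) (compositions s₂ m₂) (λ α β → f (0 ∷ α) (0 ∷ β))
      + sumOver² (compositions s₁ m₁) (starTails s₂ m₂) (λ α β → f (0 ∷ α) (addStar β))
      + sumOver² (starTails s₁ m₁) (compositions s₂ m₂) (λ α β → f (addStar α) (0 ∷ β))
      + sumOver² (starTails s₁ m₁) (starTails s₂ m₂) (λ α β → f (addStar α) (addStar β))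
sumOver²-compositions s₁ m₁ s₂ m₂ f = begin
  sumOver (compositions s₁ (suc m₁)) (λ α → sumOver (compositions s₂ (suc m₂)) (f α))
    ≡⟨ sumOver-compositions s₁ m₁ _ ⟩
  sumOver (compositions s₁ m₁) (λ α → inner (0 ∷ α)) + sumOver (starTails s₁ m₁) (λ α → inner (addStar α))
    ≡⟨ cong₂ _+_ (trans (sumOver-cong (compositions s₁ m₁) (λ α → sumOver-compositions s₂ m₂ (f (0 ∷ α))))
                        (sumOver-+ (compositions s₁ m₁) _ _))
                 (trans (sumOver-cong (starTails s₁ m₁) (λ α → sumOver-compositions s₂ m₂ (f (addStar α))))
                        (sumOver-+ (starTails s₁ m₁) _ _)) ⟩
  (B₀₀ + B₀₁) + (B₁₀ + B₁₁)
    ≡⟨ sym (+-assoc (B₀₀ + B₀₁) B₁₀ B₁₁) ⟩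
  B₀₀ + B₀₁ + B₁₀ + B₁₁ ∎
  where
  inner : Vec ℕ (suc m₁) → ℕ
  inner α = sumOver (compositions s₂ (suc m₂)) (f α)
  B₀₀ = sumOver² (compositions s₁ m₁) (compositions s₂ m₂) (λ α β → f (0 ∷ α) (0 ∷ β))
  B₀₁ = sumOver² (compositions s₁ m₁) (starTails s₂ m₂) (λ α β → f (0 ∷ α) (addStar β))
  B₁₀ = sumOver² (starTails s₁ m₁) (compositions s₂ m₂) (λ α β → f (addStar α) (0 ∷ β))
  B₁₁ = sumOver² (starTails s₁ m₁) (starTails s₂ m₂) (λ α β → f (addStar α) (addStar β))

Weight : Set
Weight = ℕ → ℕ → ℕ → ∀ {n₁ n₂} → Vec ℕ n₁ → Vec ℕ n₂ → ℕ

PeelsBy : Weight → (ℕ → ℕ → ℕ) → Set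
PeelsBy W w₀ = ∀ d₁ d₂ M {n₁ n₂ k₁ k₂ a b} {α : Vec ℕ n₁} {β : Vec ℕ n₂} {α′ : Vec ℕ k₁} {β′ : Vec ℕ k₂} →
  Cons a α α′ → Cons b β β′ → W d₁ d₂ (suc M) α β ≡ w₀ d₁ d₂ + W (a + d₁) (b + d₂) M α′ β′

unitWeight : Weight
unitWeight _ _ _ _ _ = 1

unitWeight-peels : PeelsBy unitWeight (λ _ _ → 0)
unitWeight-peels _ _ _ _ _ = refl

offsetDistance-peels : PeelsBy offsetDistance (λ d₁ d₂ → ∣ d₁ - d₂ ∣)
offsetDistance-peels = offsetDistance-cons

classSum : Weight → ℕ → ℕ → ℕ → ℕ → ℕ → ℕ → ℕ → ℕ
classSum W d₁ d₂ M p q u v =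
  sumOver² (compositions (p + u) (suc (q + v))) (compositions (p + v) (suc (q + u)))
           (λ α β → inClass M p q u v α β * W d₁ d₂ M α β)

module FirstLetters (W : Weight) (d₁ d₂ M p q u v : ℕ) where
  barBarSum barStarSum starBarSum starStarSum : ℕ
  barBarSum   = sumOver² (compositions (p + u) (q + v)) (compositions (p + v) (q + u))
                         (λ α β → inClass (suc M) p q u v (0 ∷ α) (0 ∷ β) * W d₁ d₂ M α β)
  barStarSum  = sumOver² (compositions (p + u) (q + v)) (starTails (p + v) (q + u))
                         (λ α β → inClass (suc M) p q u v (0 ∷ α) (addStar β) * W d₁ (suc d₂) M α β)
  starBarSum  = sumOver² (starTails (p + u) (q + v)) (compositions (p + v) (q + u))
                         (λ α β → inClass (suc M) p q u v (addStar α) (0 ∷ β) * W (suc d₁) d₂ M α β)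
  starStarSum = sumOver² (starTails (p + u) (q + v)) (starTails (p + v) (q + u))
                         (λ α β → inClass (suc M) p q u v (addStar α) (addStar β) * W (suc d₁) (suc d₂) M α β)

  classSum-firstLetters : ∀ {w₀} → PeelsBy W w₀ →
    classSum W d₁ d₂ (suc M) p q u v
      ≡ w₀ d₁ d₂ * classSum unitWeight d₁ d₂ (suc M) p q u v + (barBarSum + barStarSum + starBarSum + starStarSum)
  classSum-firstLetters {w₀} peels = begin
    classSum W d₁ d₂ (suc M) p q u v
      ≡⟨ sumOver²-compositions (p + u) (q + v) (p + v) (q + u) _ ⟩
    _ ≡⟨ cong₂ _+_ (cong₂ _+_ (cong₂ _+_ (block {a = 0} {b = 0} (compositions (p + u) (q + v)) (compositions (p + v) (q + u)) cons-bar cons-bar)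
                                        (block {a = 0} {b = 1} (compositions (p + u) (q + v)) (starTails (p + v) (q + u)) cons-bar cons-star))
                              (block {a = 1} {b = 0} (starTails (p + u) (q + v)) (compositions (p + v) (q + u)) cons-star cons-bar))
                   (block {a = 1} {b = 1} (starTails (p + u) (q + v)) (starTails (p + v) (q + u)) cons-star cons-star) ⟩
    (w * c₀₀ + barBarSum) + (w * c₀₁ + barStarSum) + (w * c₁₀ + starBarSum) + (w * c₁₁ + starStarSum)
      ≡⟨ regroup w c₀₀ c₀₁ c₁₀ c₁₁ barBarSum barStarSum starBarSum starStarSum ⟩
    w * (c₀₀ + c₀₁ + c₁₀ + c₁₁) + (barBarSum + barStarSum + starBarSum + starStarSum)
      ≡⟨ cong (λ z → w * z + (barBarSum + barStarSum + starBarSum + starStarSum))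
              (sym (sumOver²-compositions (p + u) (q + v) (p + v) (q + u) (λ α β → inClass (suc M) p q u v α β * 1))) ⟩
    w * classSum unitWeight d₁ d₂ (suc M) p q u v + (barBarSum + barStarSum + starBarSum + starStarSum) ∎
    where
    w = w₀ d₁ d₂
    c₀₀ = sumOver² (compositions (p + u) (q + v)) (compositions (p + v) (q + u)) (λ α β → inClass (suc M) p q u v (0 ∷ α) (0 ∷ β) * 1)
    c₀₁ = sumOver² (compositions (p + u) (q + v)) (starTails (p + v) (q + u)) (λ α β → inClass (suc M) p q u v (0 ∷ α) (addStar β) * 1)
    c₁₀ = sumOver² (starTails (p + u) (q + v)) (compositions (p + v) (q + u)) (λ α β → inClass (suc M) p q u v (addStar α) (0 ∷ β) * 1)
    c₁₁ = sumOver² (starTails (p + u) (q + v)) (starTails (p + v) (q + u)) (λ α β → inClass (suc M) p q u v (addStar α) (addStar β) * 1)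
    block : ∀ {k₁ k₂ n₁ n₂ a b} (xs : List (Vec ℕ k₁)) (ys : List (Vec ℕ k₂)) {F : Vec ℕ k₁ → Vec ℕ n₁} {G : Vec ℕ k₂ → Vec ℕ n₂} →
      (∀ α → Cons a (F α) α) → (∀ β → Cons b (G β) β) →
      sumOver² xs ys (λ α β → inClass (suc M) p q u v (F α) (G β) * W d₁ d₂ (suc M) (F α) (G β))
        ≡ w * sumOver² xs ys (λ α β → inClass (suc M) p q u v (F α) (G β) * 1)
          + sumOver² xs ys (λ α β → inClass (suc M) p q u v (F α) (G β) * W (a + d₁) (b + d₂) M α β)
    block {a = a} {b} xs ys {F} {G} cF cG =
      trans (sumOver²-cong xs ys (λ α β → cong (inClass (suc M) p q u v (F α) (G β) *_) (peels d₁ d₂ M (cF α) (cG β))))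
            (sumOver²-peel xs ys (λ α β → inClass (suc M) p q u v (F α) (G β)) (λ α β → W (a + d₁) (b + d₂) M α β) w)
    regroup : ∀ w a b c d e f g h → (w * a + e) + (w * b + f) + (w * c + g) + (w * d + h) ≡ w * (a + b + c + d) + (e + f + g + h)
    regroup = solve-∀

module _ (W : Weight) (d₁ d₂ M : ℕ) where
  open FirstLetters W d₁ d₂ M

  private
    vanish₂ : ∀ a b c w → a * 0 * b * c * w ≡ 0
    vanish₂ = solve-∀
    vanish₃ : ∀ a b c w → a * b * 0 * c * w ≡ 0
    vanish₃ = solve-∀
    vanish₄ : ∀ a b c w → a * b * c * 0 * w ≡ 0
    vanish₄ = solve-∀

  barBarSum≡ : ∀ p q u v → barBarSum p q u v ≡ prev (λ q′ → classSum W d₁ d₂ M p q′ u v) q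
  barBarSum≡ p zero    u v = sumOver²-zero (compositions (p + u) (0 + v)) (compositions (p + v) (0 + u)) _ (λ α β →
    trans (cong (_* W d₁ d₂ M α β) (inClass-cons M p 0 u v (cons-bar α) (cons-bar β)))
          (vanish₂ (δ (pairCount starStar α β M) p) (δ (pairCount starBar α β M) u) (δ (pairCount barStar α β M) v) _))
  barBarSum≡ p (suc q) u v = sumOver²-cong (compositions (p + u) (suc q + v)) (compositions (p + v) (suc q + u)) (λ α β →
    cong (_* W d₁ d₂ M α β) (inClass-cons M p (suc q) u v (cons-bar α) (cons-bar β)))

  starStarSum≡ : ∀ p q u v → starStarSum p q u v ≡ prev (λ p′ → classSum W (suc d₁) (suc d₂) M p′ q u v) p
  starStarSum≡ zero    q u v = sumOver²-zero (starTails u (q + v)) (starTails v (q + u)) _ (λ α β →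
    cong (_* W (suc d₁) (suc d₂) M α β) (inClass-cons M 0 q u v (cons-star α) (cons-star β)))
  starStarSum≡ (suc p) q u v = sumOver²-cong (compositions (p + u) (suc (q + v))) (compositions (p + v) (suc (q + u))) (λ α β →
    cong (_* W (suc d₁) (suc d₂) M α β) (inClass-cons M (suc p) q u v (cons-star α) (cons-star β)))

  starBarSum≡ : ∀ p q u v → starBarSum p q u v ≡ prev (λ u′ → classSum W (suc d₁) d₂ M p q u′ v) u
  starBarSum≡ p q zero    v = sumOver²-zero (starTails (p + 0) (q + v)) (compositions (p + v) (q + 0)) _ (λ α β →
    trans (cong (_* W (suc d₁) d₂ M α β) (inClass-cons M p q 0 v (cons-star α) (cons-bar β)))
          (vanish₃ (δ (pairCount starStar α β M) p) (δ (pairCount barBar α β M) q) (δ (pairCount barStar α β M) v) _))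
  starBarSum≡ p q (suc u) v rewrite +-suc p u | +-suc q u =
    sumOver²-cong (compositions (p + u) (suc (q + v))) (compositions (p + v) (suc (q + u))) (λ α β →
    cong (_* W (suc d₁) d₂ M α β) (inClass-cons M p q (suc u) v (cons-star α) (cons-bar β)))

  barStarSum≡ : ∀ p q u v → barStarSum p q u v ≡ prev (λ v′ → classSum W d₁ (suc d₂) M p q u v′) v
  barStarSum≡ p q u zero    = sumOver²-zero (compositions (p + u) (q + 0)) (starTails (p + 0) (q + u)) _ (λ α β →
    trans (cong (_* W d₁ (suc d₂) M α β) (inClass-cons M p q u 0 (cons-bar α) (cons-star β)))
          (vanish₄ (δ (pairCount starStar α β M) p) (δ (pairCount barBar α β M) q) (δ (pairCount starBar α β M) u) _))
  barStarSum≡ p q u (suc v) rewrite +-suc p v | +-suc q v =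
    sumOver²-cong (compositions (p + u) (suc (q + v))) (compositions (p + v) (suc (q + u))) (λ α β →
    cong (_* W d₁ (suc d₂) M α β) (inClass-cons M p q u (suc v) (cons-bar α) (cons-star β)))

classSum-suc : ∀ {W w₀} → PeelsBy W w₀ → ∀ d₁ d₂ M p q u v →
  classSum W d₁ d₂ (suc M) p q u v
    ≡ w₀ d₁ d₂ * classSum unitWeight d₁ d₂ (suc M) p q u v
      + (prev (λ q′ → classSum W d₁ d₂ M p q′ u v) q + prev (λ v′ → classSum W d₁ (suc d₂) M p q u v′) v
         + prev (λ u′ → classSum W (suc d₁) d₂ M p q u′ v) u + prev (λ p′ → classSum W (suc d₁) (suc d₂) M p′ q u v) p)
classSum-suc {W} {w₀} peels d₁ d₂ M p q u v =
  trans (FirstLetters.classSum-firstLetters W d₁ d₂ M p q u v peels)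
        (cong (w₀ d₁ d₂ * classSum unitWeight d₁ d₂ (suc M) p q u v +_)
              (cong₂ _+_ (cong₂ _+_ (cong₂ _+_ (barBarSum≡ W d₁ d₂ M p q u v) (barStarSum≡ W d₁ d₂ M p q u v))
                                    (starBarSum≡ W d₁ d₂ M p q u v))
                         (starStarSum≡ W d₁ d₂ M p q u v)))

-- Class sums in closed form

prev-cong : ∀ {f g : ℕ → ℕ} n → (∀ n′ → n ≡ suc n′ → f n′ ≡ g n′) → prev f n ≡ prev g n
prev-cong zero    eq = refl
prev-cong (suc n) eq = eq n refl

prev-mid : ∀ a b (f : ℕ → ℕ) n → prev (λ x → a * f x * b) n ≡ a * prev f n * b
prev-mid a b f zero    = sym (cong (_* b) (*-zeroʳ a))
prev-mid a b f (suc n) = refl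

binom-lattice : ∀ p q {K} → p + q ≡ suc K → prev (λ p′ → binom (p′ + q) p′) p + prev (λ q′ → binom (p + q′) p) q ≡ binom (p + q) p
binom-lattice zero    (suc q) _ = trans (binom[n,0]≡1 q) (sym (binom[n,0]≡1 (suc q)))
binom-lattice (suc p) zero    _ = begin
  binom (p + 0) p + 0         ≡⟨ +-identityʳ _ ⟩
  binom (p + 0) p             ≡⟨ cong (λ z → binom z p) (+-identityʳ p) ⟩
  binom p p                   ≡⟨ binom[n,n]≡1 p ⟩
  1                           ≡⟨ sym (binom[n,n]≡1 (suc p)) ⟩
  binom (suc p) (suc p)       ≡⟨ cong (λ z → binom z (suc p)) (sym (+-identityʳ (suc p))) ⟩
  binom (suc p + 0) (suc p)   ∎
binom-lattice (suc p) (suc q) _ = cong (binom (p + suc q) p +_) (cong (λ z → binom z (suc p)) (sym (+-suc p q)))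

classSize : ℕ → ℕ → ℕ → ℕ → ℕ → ℕ
classSize M p q u v = binom M (u + v) * binom (p + q) p * binom (u + v) u

prev-*ˡ : ∀ c (f : ℕ → ℕ) n → prev (λ x → c * f x) n ≡ c * prev f n
prev-*ˡ c f zero    = sym (*-zeroʳ c)
prev-*ˡ c f (suc n) = refl

mismatch-lattice : ∀ M P u v {J} → u + v ≡ suc J →
  prev (λ u′ → binom M (u′ + v) * P * binom (u′ + v) u′) u + prev (λ v′ → binom M (u + v′) * P * binom (u + v′) u) v
    ≡ binom M J * P * binom (u + v) u
mismatch-lattice M P u v {J} eq = begin
  prev (λ u′ → binom M (u′ + v) * P * binom (u′ + v) u′) u + prev (λ v′ → binom M (u + v′) * P * binom (u + v′) u) v
    ≡⟨ cong₂ _+_ (prev-cong u (λ u′ u≡ → cong (λ z → binom M z * P * binom (u′ + v) u′) (fewer-u u′ u≡)))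
                 (prev-cong v (λ v′ v≡ → cong (λ z → binom M z * P * binom (u + v′) u) (fewer-v v′ v≡))) ⟩
  prev (λ u′ → c * binom (u′ + v) u′) u + prev (λ v′ → c * binom (u + v′) u) v
    ≡⟨ cong₂ _+_ (prev-*ˡ c _ u) (prev-*ˡ c _ v) ⟩
  c * prev (λ u′ → binom (u′ + v) u′) u + c * prev (λ v′ → binom (u + v′) u) v
    ≡⟨ sym (*-distribˡ-+ c _ _) ⟩
  c * (prev (λ u′ → binom (u′ + v) u′) u + prev (λ v′ → binom (u + v′) u) v)
    ≡⟨ cong (c *_) (binom-lattice u v eq) ⟩
  c * binom (u + v) u ∎
  where
  c = binom M J * P
  fewer-u : ∀ u′ → u ≡ suc u′ → u′ + v ≡ J
  fewer-u u′ refl = suc-injective eq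
  fewer-v : ∀ v′ → v ≡ suc v′ → u + v′ ≡ J
  fewer-v v′ refl = suc-injective (trans (sym (+-suc u v′)) eq)

matched-lattice : ∀ M p q u v {K} → p + q ≡ suc K →
  prev (λ p′ → classSize M p′ q u v) p + prev (λ q′ → classSize M p q′ u v) q ≡ classSize M p q u v
matched-lattice M p q u v eq = begin
  prev (λ p′ → a * binom (p′ + q) p′ * b) p + prev (λ q′ → a * binom (p + q′) p * b) q
    ≡⟨ cong₂ _+_ (prev-mid a b _ p) (prev-mid a b _ q) ⟩
  a * prev (λ p′ → binom (p′ + q) p′) p * b + a * prev (λ q′ → binom (p + q′) p) q * b
    ≡⟨ factor a b _ _ ⟩
  a * (prev (λ p′ → binom (p′ + q) p′) p + prev (λ q′ → binom (p + q′) p) q) * b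
    ≡⟨ cong (λ z → a * z * b) (binom-lattice p q eq) ⟩
  a * binom (p + q) p * b ∎
  where
  a = binom M (u + v)
  b = binom (u + v) u
  factor : ∀ a b x y → a * x * b + a * y * b ≡ a * (x + y) * b
  factor = solve-∀

zero-or-suc : ∀ a b → (a ≡ 0 × b ≡ 0) ⊎ ∃ λ K → a + b ≡ suc K
zero-or-suc zero    zero    = inj₁ (refl , refl)
zero-or-suc zero    (suc b) = inj₂ (b , refl)
zero-or-suc (suc a) b       = inj₂ (a + b , refl)

classSize-suc : ∀ M p q u v → suc M ≡ p + u + (q + v) →
  classSize (suc M) p q u v
    ≡ prev (λ q′ → classSize M p q′ u v) q + prev (λ v′ → classSize M p q u v′) v
      + prev (λ u′ → classSize M p q u′ v) u + prev (λ p′ → classSize M p′ q u v) p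
classSize-suc M p q u v eq with zero-or-suc u v | zero-or-suc p q
... | inj₁ (refl , refl) | _ = begin
  binom (suc M) 0 * binom (p + q) p * 1    ≡⟨ cong (λ z → z * binom (p + q) p * 1) (sym (binom[n,0]≡1 M)) ⟩
  classSize M p q 0 0                      ≡⟨ sym (matched-lattice M p q 0 0 (sym (trans eq (unpad p q)))) ⟩
  Pp + Pq                                  ≡⟨ swap Pp Pq ⟩
  Pq + 0 + 0 + Pp                          ∎
  where
  Pp = prev (λ p′ → classSize M p′ q 0 0) p
  Pq = prev (λ q′ → classSize M p q′ 0 0) q
  unpad : ∀ p q → p + 0 + (q + 0) ≡ p + q
  unpad = solve-∀
  swap : ∀ a b → a + b ≡ b + 0 + 0 + a
  swap = solve-∀
... | inj₂ (J , u+v≡1+J) | inj₁ (refl , refl) = begin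
  binom (suc M) (u + v) * 1 * binom (u + v) u  ≡⟨ cong (λ z → binom (suc M) z * 1 * binom (u + v) u) (sym eq) ⟩
  binom (suc M) (suc M) * 1 * binom (u + v) u  ≡⟨ cong (λ z → z * 1 * binom (u + v) u) (trans (binom[n,n]≡1 (suc M)) (sym (binom[n,n]≡1 M))) ⟩
  binom M M * 1 * binom (u + v) u              ≡⟨ sym (mismatch-lattice M 1 u v (sym eq)) ⟩
  Pu + Pv                                      ≡⟨ swap Pu Pv ⟩
  0 + Pv + Pu + 0                              ∎
  where
  Pu = prev (λ u′ → classSize M 0 0 u′ v) u
  Pv = prev (λ v′ → classSize M 0 0 u v′) v
  swap : ∀ a b → a + b ≡ 0 + b + a + 0
  swap = solve-∀
... | inj₂ (J , u+v≡1+J) | inj₂ (K , p+q≡1+K) = begin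
  binom (suc M) (u + v) * P * C                         ≡⟨ cong (λ z → binom (suc M) z * P * C) u+v≡1+J ⟩
  (binom M J + binom M (suc J)) * P * C                 ≡⟨ distrib (binom M J) (binom M (suc J)) P C ⟩
  binom M J * P * C + binom M (suc J) * P * C           ≡⟨ cong₂ _+_ (sym (mismatch-lattice M P u v u+v≡1+J))
                                                                    (cong (λ z → binom M z * P * C) (sym u+v≡1+J)) ⟩
  Pu + Pv + classSize M p q u v                         ≡⟨ cong (Pu + Pv +_) (sym (matched-lattice M p q u v p+q≡1+K)) ⟩
  Pu + Pv + (Pp + Pq)                                   ≡⟨ regroup Pu Pv Pp Pq ⟩
  Pq + Pv + Pu + Pp                                     ∎
  where
  P = binom (p + q) p
  C = binom (u + v) u
  Pp = prev (λ p′ → classSize M p′ q u v) p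
  Pq = prev (λ q′ → classSize M p q′ u v) q
  Pu = prev (λ u′ → classSize M p q u′ v) u
  Pv = prev (λ v′ → classSize M p q u v′) v
  distrib : ∀ a b x c → (a + b) * x * c ≡ a * x * c + b * x * c
  distrib = solve-∀
  regroup : ∀ u v p q → u + v + (p + q) ≡ q + v + u + p
  regroup = solve-∀

walkSum-suc-suc : ∀ u v d₁ d₂ → walkSum u v (suc d₁) (suc d₂) ≡ walkSum u v d₁ d₂
walkSum-suc-suc zero    zero    d₁ d₂ = refl
walkSum-suc-suc (suc u) zero    d₁ d₂ = cong (∣ d₁ - d₂ ∣ +_) (walkSum-suc-suc u zero (suc d₁) d₂)
walkSum-suc-suc zero    (suc v) d₁ d₂ = cong (∣ d₁ - d₂ ∣ +_) (walkSum-suc-suc zero v d₁ (suc d₂))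
walkSum-suc-suc (suc u) (suc v) d₁ d₂ =
  cong₂ (λ x y → ∣ d₁ - d₂ ∣ * binom (suc u + suc v) (suc u) + x + y)
        (walkSum-suc-suc u (suc v) (suc d₁) d₂) (walkSum-suc-suc (suc u) v d₁ (suc d₂))

walkSum-rec : ∀ u v d₁ d₂ {J} → u + v ≡ suc J →
  walkSum u v d₁ d₂ ≡ ∣ d₁ - d₂ ∣ * binom (u + v) u + prev (λ u′ → walkSum u′ v (suc d₁) d₂) u + prev (λ v′ → walkSum u v′ d₁ (suc d₂)) v
walkSum-rec zero    (suc v) d₁ d₂ _ = cong (_+ walkSum zero v d₁ (suc d₂)) (sym (trans (+-identityʳ _) (*-identityʳ _)))
walkSum-rec (suc u) zero    d₁ d₂ _ = begin
  ∣ d₁ - d₂ ∣ + W                               ≡⟨ cong (_+ W) (sym (*-identityʳ ∣ d₁ - d₂ ∣)) ⟩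
  ∣ d₁ - d₂ ∣ * 1 + W                           ≡⟨ cong (λ z → ∣ d₁ - d₂ ∣ * z + W) (sym one) ⟩
  ∣ d₁ - d₂ ∣ * binom (suc u + 0) (suc u) + W   ≡⟨ sym (+-identityʳ _) ⟩
  ∣ d₁ - d₂ ∣ * binom (suc u + 0) (suc u) + W + 0 ∎
  where
  W = walkSum u zero (suc d₁) d₂
  one : binom (suc u + 0) (suc u) ≡ 1
  one = trans (cong (λ z → binom z (suc u)) (+-identityʳ (suc u))) (binom[n,n]≡1 (suc u))
walkSum-rec (suc u) (suc v) d₁ d₂ _ = refl

classDistance : ℕ → ℕ → ℕ → ℕ → ℕ → ℕ → ℕ → ℕ
classDistance M p q u v d₁ d₂ = binom (suc M) (suc (u + v)) * binom (p + q) p * walkSum u v d₁ d₂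

prev-zero : ∀ (f : ℕ → ℕ) n → (∀ x → f x ≡ 0) → prev f n ≡ 0
prev-zero f zero    eq = refl
prev-zero f (suc n) eq = eq n

prev-fewer-u : ∀ N P u v (B : ℕ → ℕ) → prev (λ u′ → binom N (suc (u′ + v)) * P * B u′) u ≡ binom N (u + v) * P * prev B u
prev-fewer-u N P zero    v B = sym (*-zeroʳ (binom N v * P))
prev-fewer-u N P (suc u) v B = refl

prev-fewer-v : ∀ N P u v (B : ℕ → ℕ) → prev (λ v′ → binom N (suc (u + v′)) * P * B v′) v ≡ binom N (u + v) * P * prev B v
prev-fewer-v N P u zero    B = sym (*-zeroʳ (binom N (u + 0) * P))
prev-fewer-v N P u (suc v) B = cong (λ z → binom N z * P * B v) (sym (+-suc u v))

classDistance-suc : ∀ M p q u v d₁ d₂ → suc M ≡ p + u + (q + v) → d₁ + u ≡ d₂ + v →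
  classDistance (suc M) p q u v d₁ d₂
    ≡ ∣ d₁ - d₂ ∣ * classSize (suc M) p q u v
      + (prev (λ q′ → classDistance M p q′ u v d₁ d₂) q + prev (λ v′ → classDistance M p q u v′ d₁ (suc d₂)) v
         + prev (λ u′ → classDistance M p q u′ v (suc d₁) d₂) u + prev (λ p′ → classDistance M p′ q u v d₁ d₂) p)
classDistance-suc M p q u v d₁ d₂ eq balanced with zero-or-suc u v | zero-or-suc p q
... | inj₁ (refl , refl) | _ = begin
  binom (suc (suc M)) 1 * binom (p + q) p * 0    ≡⟨ *-zeroʳ (binom (suc (suc M)) 1 * binom (p + q) p) ⟩
  0                                              ≡⟨ sym (cong₂ _+_ (cong (_* classSize (suc M) p q 0 0) level)
                                                                   (cong₂ (λ x y → x + 0 + 0 + y)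
                                                                          (prev-zero _ q (λ q′ → *-zeroʳ (binom (suc M) 1 * binom (p + q′) p)))
                                                                          (prev-zero _ p (λ p′ → *-zeroʳ (binom (suc M) 1 * binom (p′ + q) p′))))) ⟩
  ∣ d₁ - d₂ ∣ * classSize (suc M) p q 0 0 + (prev (λ q′ → classDistance M p q′ 0 0 d₁ d₂) q + 0 + 0 + prev (λ p′ → classDistance M p′ q 0 0 d₁ d₂) p) ∎
  where
  level : ∣ d₁ - d₂ ∣ ≡ 0
  level = m≡n⇒∣m-n∣≡0 (trans (sym (+-identityʳ d₁)) (trans balanced (+-identityʳ d₂)))
... | inj₂ (J , u+v≡1+J) | inj₁ (refl , refl) = begin
  binom (suc (suc M)) (suc (u + v)) * 1 * W     ≡⟨ cong (λ z → z * 1 * W) (trans (cong (λ z → binom (suc (suc M)) (suc z)) (sym eq)) (binom[n,n]≡1 (suc (suc M)))) ⟩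
  1 * 1 * W                                     ≡⟨ cong (1 * 1 *_) (walkSum-rec u v d₁ d₂ u+v≡1+J) ⟩
  1 * 1 * (d * binom (u + v) u + Wu + Wv)       ≡⟨ regroup d (binom (u + v) u) Wu Wv ⟩
  d * (1 * 1 * binom (u + v) u) + (0 + 1 * 1 * Wv + 1 * 1 * Wu + 0)
    ≡⟨ cong₂ (λ a b → d * (a * 1 * binom (u + v) u) + (0 + a * 1 * Wv + b * 1 * Wu + 0)) (sym full) (sym full) ⟩
  d * classSize (suc M) 0 0 u v + (0 + a * 1 * Wv + a * 1 * Wu + 0)
    ≡⟨ cong₂ (λ x y → d * classSize (suc M) 0 0 u v + (0 + x + y + 0))
             (sym (prev-fewer-v (suc M) 1 u v (λ v′ → walkSum u v′ d₁ (suc d₂))))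
             (sym (prev-fewer-u (suc M) 1 u v (λ u′ → walkSum u′ v (suc d₁) d₂))) ⟩
  d * classSize (suc M) 0 0 u v + (0 + prev (λ v′ → classDistance M 0 0 u v′ d₁ (suc d₂)) v + prev (λ u′ → classDistance M 0 0 u′ v (suc d₁) d₂) u + 0) ∎
  where
  W = walkSum u v d₁ d₂
  d = ∣ d₁ - d₂ ∣
  a = binom (suc M) (u + v)
  Wu = prev (λ u′ → walkSum u′ v (suc d₁) d₂) u
  Wv = prev (λ v′ → walkSum u v′ d₁ (suc d₂)) v
  full : a ≡ 1
  full = trans (cong (binom (suc M)) (sym eq)) (binom[n,n]≡1 (suc M))
  regroup : ∀ d c x y → 1 * 1 * (d * c + x + y) ≡ d * (1 * 1 * c) + (0 + 1 * 1 * y + 1 * 1 * x + 0)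
  regroup = solve-∀
... | inj₂ (J , u+v≡1+J) | inj₂ (K , p+q≡1+K) = begin
  (a + b) * P * W
    ≡⟨ cong₂ (λ x y → (a + b) * x * y) (sym (binom-lattice p q p+q≡1+K)) (walkSum-rec u v d₁ d₂ u+v≡1+J) ⟩
  (a + b) * (Lp + Lq) * (d * c + Wu + Wv)
    ≡⟨ expand a b Lp Lq d c Wu Wv ⟩
  d * (a * (Lp + Lq) * c) + (b * Lq * (d * c + Wu + Wv) + a * (Lp + Lq) * Wv + a * (Lp + Lq) * Wu + b * Lp * (d * c + Wu + Wv))
    ≡⟨ cong₂ (λ x y → d * (a * x * c) + (b * Lq * y + a * x * Wv + a * x * Wu + b * Lp * y))
             (binom-lattice p q p+q≡1+K) (sym (walkSum-rec u v d₁ d₂ u+v≡1+J)) ⟩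
  d * (a * P * c) + (b * Lq * W + a * P * Wv + a * P * Wu + b * Lp * W)
    ≡⟨ cong (d * (a * P * c) +_)
            (cong₂ _+_ (cong₂ _+_ (cong₂ _+_ (sym (prev-mid b W _ q))
                                            (sym (prev-fewer-v (suc M) P u v (λ v′ → walkSum u v′ d₁ (suc d₂)))))
                                  (sym (prev-fewer-u (suc M) P u v (λ u′ → walkSum u′ v (suc d₁) d₂))))
                       (sym (prev-mid b W _ p))) ⟩
  d * classSize (suc M) p q u v
    + (prev (λ q′ → classDistance M p q′ u v d₁ d₂) q + prev (λ v′ → classDistance M p q u v′ d₁ (suc d₂)) v
       + prev (λ u′ → classDistance M p q u′ v (suc d₁) d₂) u + prev (λ p′ → classDistance M p′ q u v d₁ d₂) p) ∎
  where
  a = binom (suc M) (u + v)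
  b = binom (suc M) (suc (u + v))
  P = binom (p + q) p
  W = walkSum u v d₁ d₂
  d = ∣ d₁ - d₂ ∣
  c = binom (u + v) u
  Lp = prev (λ p′ → binom (p′ + q) p′) p
  Lq = prev (λ q′ → binom (p + q′) p) q
  Wu = prev (λ u′ → walkSum u′ v (suc d₁) d₂) u
  Wv = prev (λ v′ → walkSum u v′ d₁ (suc d₂)) v
  expand : ∀ a b x y d c u v →
    (a + b) * (x + y) * (d * c + u + v)
      ≡ d * (a * (x + y) * c) + (b * y * (d * c + u + v) + a * (x + y) * v + a * (x + y) * u + b * x * (d * c + u + v))
  expand = solve-∀

module Fewer (M p q u v : ℕ) (eq : suc M ≡ p + u + (q + v)) where
  fewer-q : ∀ q′ → q ≡ suc q′ → M ≡ p + u + (q′ + v)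
  fewer-q q′ refl = suc-injective (trans eq (shift p u q′ v))
    where
    shift : ∀ p u q v → p + u + (suc q + v) ≡ suc (p + u + (q + v))
    shift = solve-∀

  fewer-v : ∀ v′ → v ≡ suc v′ → M ≡ p + u + (q + v′)
  fewer-v v′ refl = suc-injective (trans eq (shift p u q v′))
    where
    shift : ∀ p u q v → p + u + (q + suc v) ≡ suc (p + u + (q + v))
    shift = solve-∀

  fewer-u : ∀ u′ → u ≡ suc u′ → M ≡ p + u′ + (q + v)
  fewer-u u′ refl = suc-injective (trans eq (shift p u′ q v))
    where
    shift : ∀ p u q v → p + suc u + (q + v) ≡ suc (p + u + (q + v))
    shift = solve-∀

  fewer-p : ∀ p′ → p ≡ suc p′ → M ≡ p′ + u + (q + v)
  fewer-p p′ refl = suc-injective eq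

classSum-unit : ∀ M p q u v d₁ d₂ → M ≡ p + u + (q + v) → classSum unitWeight d₁ d₂ M p q u v ≡ classSize M p q u v
classSum-unit zero    zero    zero    zero    zero    d₁ d₂ eq = refl
classSum-unit zero    (suc p) q       u       v       d₁ d₂ ()
classSum-unit zero    zero    q       (suc u) v       d₁ d₂ ()
classSum-unit zero    zero    (suc q) zero    v       d₁ d₂ ()
classSum-unit zero    zero    zero    zero    (suc v) d₁ d₂ ()
classSum-unit (suc M) p q u v d₁ d₂ eq = begin
  classSum unitWeight d₁ d₂ (suc M) p q u v
    ≡⟨ classSum-suc {unitWeight} {λ _ _ → 0} unitWeight-peels d₁ d₂ M p q u v ⟩
  0 + (prev (λ q′ → classSum unitWeight d₁ d₂ M p q′ u v) q + prev (λ v′ → classSum unitWeight d₁ (suc d₂) M p q u v′) v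
       + prev (λ u′ → classSum unitWeight (suc d₁) d₂ M p q u′ v) u + prev (λ p′ → classSum unitWeight (suc d₁) (suc d₂) M p′ q u v) p)
    ≡⟨ cong₂ _+_ (cong₂ _+_ (cong₂ _+_
         (prev-cong q (λ q′ q≡ → classSum-unit M p q′ u v d₁ d₂ (fewer-q q′ q≡)))
         (prev-cong v (λ v′ v≡ → classSum-unit M p q u v′ d₁ (suc d₂) (fewer-v v′ v≡))))
         (prev-cong u (λ u′ u≡ → classSum-unit M p q u′ v (suc d₁) d₂ (fewer-u u′ u≡))))
         (prev-cong p (λ p′ p≡ → classSum-unit M p′ q u v (suc d₁) (suc d₂) (fewer-p p′ p≡))) ⟩
  prev (λ q′ → classSize M p q′ u v) q + prev (λ v′ → classSize M p q u v′) v
    + prev (λ u′ → classSize M p q u′ v) u + prev (λ p′ → classSize M p′ q u v) p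
    ≡⟨ sym (classSize-suc M p q u v eq) ⟩
  classSize (suc M) p q u v ∎
  where open Fewer M p q u v eq

classSum-distance : ∀ M p q u v d₁ d₂ → M ≡ p + u + (q + v) → d₁ + u ≡ d₂ + v →
  classSum offsetDistance d₁ d₂ M p q u v ≡ classDistance M p q u v d₁ d₂
classSum-distance zero    zero    zero    zero    zero    d₁ d₂ eq bal = refl
classSum-distance zero    (suc p) q       u       v       d₁ d₂ () bal
classSum-distance zero    zero    q       (suc u) v       d₁ d₂ () bal
classSum-distance zero    zero    (suc q) zero    v       d₁ d₂ () bal
classSum-distance zero    zero    zero    zero    (suc v) d₁ d₂ () bal
classSum-distance (suc M) p q u v d₁ d₂ eq bal = begin
  classSum offsetDistance d₁ d₂ (suc M) p q u v
    ≡⟨ classSum-suc {offsetDistance} offsetDistance-peels d₁ d₂ M p q u v ⟩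
  ∣ d₁ - d₂ ∣ * classSum unitWeight d₁ d₂ (suc M) p q u v
    + (prev (λ q′ → classSum offsetDistance d₁ d₂ M p q′ u v) q + prev (λ v′ → classSum offsetDistance d₁ (suc d₂) M p q u v′) v
       + prev (λ u′ → classSum offsetDistance (suc d₁) d₂ M p q u′ v) u + prev (λ p′ → classSum offsetDistance (suc d₁) (suc d₂) M p′ q u v) p)
    ≡⟨ cong₂ _+_ (cong (∣ d₁ - d₂ ∣ *_) (classSum-unit (suc M) p q u v d₁ d₂ eq))
                 (cong₂ _+_ (cong₂ _+_ (cong₂ _+_
                   (prev-cong q (λ q′ q≡ → classSum-distance M p q′ u v d₁ d₂ (fewer-q q′ q≡) bal))
                   (prev-cong v (λ v′ v≡ → classSum-distance M p q u v′ d₁ (suc d₂) (fewer-v v′ v≡) (bal-v v′ v≡))))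
                   (prev-cong u (λ u′ u≡ → classSum-distance M p q u′ v (suc d₁) d₂ (fewer-u u′ u≡) (bal-u u′ u≡))))
                   (prev-cong p (λ p′ p≡ → trans (classSum-distance M p′ q u v (suc d₁) (suc d₂) (fewer-p p′ p≡) (cong suc bal))
                                                 (cong (binom (suc M) (suc (u + v)) * binom (p′ + q) p′ *_) (walkSum-suc-suc u v d₁ d₂))))) ⟩
  ∣ d₁ - d₂ ∣ * classSize (suc M) p q u v
    + (prev (λ q′ → classDistance M p q′ u v d₁ d₂) q + prev (λ v′ → classDistance M p q u v′ d₁ (suc d₂)) v
       + prev (λ u′ → classDistance M p q u′ v (suc d₁) d₂) u + prev (λ p′ → classDistance M p′ q u v d₁ d₂) p)
    ≡⟨ sym (classDistance-suc M p q u v d₁ d₂ eq bal) ⟩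
  classDistance (suc M) p q u v d₁ d₂ ∎
  where
  open Fewer M p q u v eq
  bal-v : ∀ v′ → v ≡ suc v′ → d₁ + u ≡ suc d₂ + v′
  bal-v v′ refl = trans bal (+-suc d₂ v′)
  bal-u : ∀ u′ → u ≡ suc u′ → suc d₁ + u′ ≡ d₂ + v
  bal-u u′ refl = trans (sym (+-suc d₁ u′)) bal

-- Summing over all pairs

sumOver-compositions-cong : ∀ s n {f g : Vec ℕ n → ℕ} → (∀ v → sumᵥ v ≡ s → f v ≡ g v) →
  sumOver (compositions s n) f ≡ sumOver (compositions s n) g
sumOver-compositions-cong zero    zero    eq = cong (_+ 0) (eq [] refl)
sumOver-compositions-cong (suc s) zero    eq = refl
sumOver-compositions-cong s       (suc n) {f} {g} eq = begin
  sumOver (compositions s (suc n)) f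
    ≡⟨ sumOver-compositions s n f ⟩
  sumOver (compositions s n) (λ v → f (0 ∷ v)) + sumOver (starTails s n) (λ v → f (addStar v))
    ≡⟨ cong₂ _+_ (sumOver-compositions-cong s n (λ v Σv → eq (0 ∷ v) Σv)) (tails s eq) ⟩
  sumOver (compositions s n) (λ v → g (0 ∷ v)) + sumOver (starTails s n) (λ v → g (addStar v))
    ≡⟨ sym (sumOver-compositions s n g) ⟩
  sumOver (compositions s (suc n)) g ∎
  where
  tails : ∀ s → (∀ v → sumᵥ v ≡ s → f v ≡ g v) →
    sumOver (starTails s n) (λ v → f (addStar v)) ≡ sumOver (starTails s n) (λ v → g (addStar v))
  tails zero    eq = refl
  tails (suc s) eq = sumOver-compositions-cong s (suc n) (λ { (a ∷ v) Σv → eq (suc a ∷ v) (cong suc Σv) })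

starAt≤1 : ∀ {n} L (v : Vec ℕ n) → starAt L v ≤ 1
starAt≤1 L v = ≤-trans (∸-monoˡ-≤ (starsIn L v) (starsIn-suc≤ L v)) (≤-reflexive (m+n∸n≡m 1 (starsIn L v)))

Σ<-starAt : ∀ {n} M (v : Vec ℕ n) → Σ< M (λ L → starAt L v) ≡ starsIn M v
Σ<-starAt zero    v = refl
Σ<-starAt (suc M) v = trans (cong (_+ starAt M v) (Σ<-starAt M v)) (m+[n∸m]≡n (starsIn-mono M v))

letter-counts : ∀ {a b} → a ≤ 1 → b ≤ 1 →
  (starStar a b + starBar a b ≡ a) × (starStar a b + barStar a b ≡ b) × (barBar a b + starBar a b ≡ 1 ∸ b)
letter-counts z≤n       z≤n       = refl , refl , refl
letter-counts z≤n       (s≤s z≤n) = refl , refl , refl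
letter-counts (s≤s z≤n) z≤n       = refl , refl , refl
letter-counts (s≤s z≤n) (s≤s z≤n) = refl , refl , refl

module PairCounts (s m : ℕ) (α β : Vec ℕ (suc m)) (Σα : sumᵥ α ≡ s) (Σβ : sumᵥ β ≡ s) where
  M = s + m
  P = pairCount starStar α β M
  Q = pairCount barBar α β M
  U = pairCount starBar α β M
  V = pairCount barStar α β M

  stars : ∀ (γ : Vec ℕ (suc m)) → sumᵥ γ ≡ s → Σ< M (λ L → starAt L γ) ≡ s
  stars γ Σγ = trans (Σ<-starAt M γ) (trans (cong (λ z → starsIn (z + m) γ) (sym Σγ)) (trans (starsIn-all γ) Σγ))

  bars : ∀ (γ : Vec ℕ (suc m)) → sumᵥ γ ≡ s → Σ< M (λ L → 1 ∸ starAt L γ) ≡ m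
  bars γ Σγ = +-cancelʳ-≡ s _ _ (begin
    Σ< M (λ L → 1 ∸ starAt L γ) + s                              ≡⟨ cong (Σ< M (λ L → 1 ∸ starAt L γ) +_) (sym (stars γ Σγ)) ⟩
    Σ< M (λ L → 1 ∸ starAt L γ) + Σ< M (λ L → starAt L γ)        ≡⟨ sym (Σ<-+ M _ _) ⟩
    Σ< M (λ L → 1 ∸ starAt L γ + starAt L γ)                     ≡⟨ Σ<-cong′ M (λ L → m∸n+n≡m (starAt≤1 L γ)) ⟩
    Σ< M (λ _ → 1)                                               ≡⟨ trans (Σ<-const M 1) (*-identityʳ M) ⟩
    s + m                                                        ≡⟨ +-comm s m ⟩
    m + s                                                        ∎)

  combine : ∀ (h₁ h₂ : ℕ → ℕ → ℕ) (g : ℕ → ℕ) → (∀ L → h₁ (starAt L α) (starAt L β) + h₂ (starAt L α) (starAt L β) ≡ g L) →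
    pairCount h₁ α β M + pairCount h₂ α β M ≡ Σ< M g
  combine h₁ h₂ g eq = trans (sym (Σ<-+ M _ _)) (Σ<-cong′ M eq)

  P+U≡s : P + U ≡ s
  P+U≡s = trans (combine starStar starBar _ (λ L → proj₁ (letter-counts (starAt≤1 L α) (starAt≤1 L β)))) (stars α Σα)
  P+V≡s : P + V ≡ s
  P+V≡s = trans (combine starStar barStar _ (λ L → proj₁ (proj₂ (letter-counts (starAt≤1 L α) (starAt≤1 L β))))) (stars β Σβ)
  Q+U≡m : Q + U ≡ m
  Q+U≡m = trans (combine barBar starBar _ (λ L → proj₂ (proj₂ (letter-counts (starAt≤1 L α) (starAt≤1 L β))))) (bars β Σβ)

  Σ<-inClass : Σ< (suc s) (λ r → 𝟙[ r ≤ m ] * inClass M (s ∸ r) (m ∸ r) r r α β) ≡ 1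
  Σ<-inClass = trans (Σ<-cong′ (suc s) term) (Σ<-δ (suc s) U (s≤s (subst (U ≤_) P+U≡s (m≤n+m U P))))
    where
    term : ∀ r → 𝟙[ r ≤ m ] * inClass M (s ∸ r) (m ∸ r) r r α β ≡ δ U r
    term r with U ≟ r
    ... | yes refl = begin
      𝟙[ U ≤ m ] * (δ P (s ∸ U) * δ Q (m ∸ U) * δ U U * δ V U)
        ≡⟨ cong₂ (λ x y → x * (δ P (s ∸ U) * δ Q (m ∸ U) * y * δ V U)) (𝟙-yes (subst (U ≤_) Q+U≡m (m≤n+m U Q))) (δ-refl U) ⟩
      1 * (δ P (s ∸ U) * δ Q (m ∸ U) * 1 * δ V U)
        ≡⟨ cong₂ (λ x y → 1 * (δ P x * δ Q y * 1 * δ V U)) (trans (cong (_∸ U) (sym P+U≡s)) (m+n∸n≡m P U))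
                                                           (trans (cong (_∸ U) (sym Q+U≡m)) (m+n∸n≡m Q U)) ⟩
      1 * (δ P P * δ Q Q * 1 * δ V U)
        ≡⟨ cong₂ (λ x y → 1 * (x * y * 1 * δ V U)) (δ-refl P) (δ-refl Q) ⟩
      1 * (1 * 1 * 1 * δ V U)
        ≡⟨ cong (λ x → 1 * (1 * 1 * 1 * δ V x)) (sym (+-cancelˡ-≡ P V U (trans P+V≡s (sym P+U≡s)))) ⟩
      1 * (1 * 1 * 1 * δ V V)
        ≡⟨ cong (λ x → 1 * (1 * 1 * 1 * x)) (δ-refl V) ⟩
      1
        ≡⟨ sym (δ-refl U) ⟩
      δ U U ∎
    ... | no U≢r = trans (cong (λ x → 𝟙[ r ≤ m ] * (δ P (s ∸ r) * δ Q (m ∸ r) * x * δ V r)) (δ-≢ U≢r))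
                         (trans (vanish 𝟙[ r ≤ m ] (δ P (s ∸ r)) (δ Q (m ∸ r)) (δ V r)) (sym (δ-≢ U≢r)))
      where
      vanish : ∀ a b c d → a * (b * c * 0 * d) ≡ 0
      vanish = solve-∀

totalEMD≡sumOver² : ∀ s n → totalEMD s n ≡ sumOver² (compositions s n) (compositions s n) EMD
totalEMD≡sumOver² s n = begin
  sum (concatMap (λ α → map (EMD α) Cs) Cs)                ≡⟨ sum≡sumOver (concatMap (λ α → map (EMD α) Cs) Cs) ⟩
  sumOver (concatMap (λ α → map (EMD α) Cs) Cs) id         ≡⟨ sumOver-concatMap (λ α → map (EMD α) Cs) Cs id ⟩
  sumOver Cs (λ α → sumOver (map (EMD α) Cs) id)           ≡⟨ sumOver-cong Cs (λ α → sumOver-map (EMD α) Cs id) ⟩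
  sumOver² Cs Cs EMD                                       ∎
  where
  Cs = compositions s n

trinom-vanish : ∀ s m r → r ≤ s → m < r → trinom (suc (s + m)) (suc (double r)) (s ∸ r) ≡ 0
trinom-vanish s m r r≤s m<r with double r ≤? s + m
... | no 2r≰M = cong (_* binom (s + m ∸ double r) (s ∸ r)) (n<k⇒binom[n,k]≡0 (s≤s (≰⇒> 2r≰M)))
... | yes 2r≤M = trans (cong (binom (suc (s + m)) (suc (double r)) *_) (n<k⇒binom[n,k]≡0 rest<s∸r))
                       (*-zeroʳ (binom (suc (s + m)) (suc (double r))))
  where
  rest = s + m ∸ double r
  rest+r+r≡M : rest + r + r ≡ s + m
  rest+r+r≡M = trans (+-assoc rest r r) (trans (cong (rest +_) (sym (double≡+ r))) (m∸n+n≡m 2r≤M))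
  rest<s∸r : rest < s ∸ r
  rest<s∸r = m+n≤o⇒m≤o∸n (suc rest) (+-cancelʳ-< r (rest + r) s (subst (_< s + r) (sym rest+r+r≡M) (+-monoʳ-< s m<r)))

sumOver²-compositions-≡ : ∀ {s s′ m m′} → s ≡ s′ → m ≡ m′ → (F : ∀ {k₁ k₂} → Vec ℕ k₁ → Vec ℕ k₂ → ℕ) →
  sumOver² (compositions s (suc m)) (compositions s (suc m)) F ≡ sumOver² (compositions s′ (suc m′)) (compositions s′ (suc m′)) F
sumOver²-compositions-≡ refl refl F = refl

emdFormula-term : ∀ s m r → r ≤ s →
  sumOver² (compositions s (suc m)) (compositions s (suc m))
           (λ α β → 𝟙[ r ≤ m ] * (inClass (s + m) (s ∸ r) (m ∸ r) r r α β * offsetDistance 0 0 (s + m) α β))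
    ≡ trinom (suc (s + m)) (suc (double r)) (s ∸ r) * walkSum r r 0 0
emdFormula-term s m r r≤s = begin
  sumOver² Cs Cs (λ α β → 𝟙[ r ≤ m ] * X α β)
    ≡⟨ trans (sumOver-cong Cs (λ α → sumOver-*ˡ Cs 𝟙[ r ≤ m ] (X α))) (sumOver-*ˡ Cs 𝟙[ r ≤ m ] _) ⟩
  𝟙[ r ≤ m ] * sumOver² Cs Cs X
    ≡⟨ inside (r ≤? m) ⟩
  trinom (suc M) (suc (double r)) (s ∸ r) * walkSum r r 0 0 ∎
  where
  M = s + m
  Cs = compositions s (suc m)
  X : ∀ {k₁ k₂} → Vec ℕ k₁ → Vec ℕ k₂ → ℕ
  X α β = inClass M (s ∸ r) (m ∸ r) r r α β * offsetDistance 0 0 M α β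
  inside : Dec (r ≤ m) → 𝟙[ r ≤ m ] * sumOver² Cs Cs X ≡ trinom (suc M) (suc (double r)) (s ∸ r) * walkSum r r 0 0
  inside (no r≰m) rewrite 𝟙-no (≰⇒> r≰m) | trinom-vanish s m r r≤s (≰⇒> r≰m) = refl
  inside (yes r≤m) rewrite 𝟙-yes r≤m = begin
    sumOver² Cs Cs X + 0
      ≡⟨ +-identityʳ _ ⟩
    sumOver² Cs Cs X
      ≡⟨ sumOver²-compositions-≡ (sym (m∸n+n≡m r≤s)) (sym (m∸n+n≡m r≤m)) X ⟩
    classSum offsetDistance 0 0 M (s ∸ r) (m ∸ r) r r
      ≡⟨ classSum-distance M (s ∸ r) (m ∸ r) r r 0 0 (sym (cong₂ _+_ (m∸n+n≡m r≤s) (m∸n+n≡m r≤m))) refl ⟩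
    binom (suc M) (suc (r + r)) * binom (s ∸ r + (m ∸ r)) (s ∸ r) * walkSum r r 0 0
      ≡⟨ cong₂ (λ a b → binom (suc M) (suc a) * binom b (s ∸ r) * walkSum r r 0 0) (sym (double≡+ r)) remaining ⟩
    trinom (suc M) (suc (double r)) (s ∸ r) * walkSum r r 0 0 ∎
    where
    remaining : s ∸ r + (m ∸ r) ≡ M ∸ double r
    remaining = sym (begin
      s + m ∸ double r                     ≡⟨ cong₂ (λ a b → a + b ∸ double r) (sym (m∸n+n≡m r≤s)) (sym (m∸n+n≡m r≤m)) ⟩
      (s ∸ r + r) + (m ∸ r + r) ∸ double r ≡⟨ cong₂ _∸_ (regroup (s ∸ r) (m ∸ r) r) (double≡+ r) ⟩
      (s ∸ r + (m ∸ r)) + (r + r) ∸ (r + r) ≡⟨ m+n∸n≡m (s ∸ r + (m ∸ r)) (r + r) ⟩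
      s ∸ r + (m ∸ r)                      ∎)
      where
      regroup : ∀ a b r → a + r + (b + r) ≡ a + b + (r + r)
      regroup = solve-∀

totalEMD≡emdFormula : ∀ s m → totalEMD s (suc m) ≡ emdFormula s m
totalEMD≡emdFormula s m = begin
  totalEMD s (suc m)
    ≡⟨ totalEMD≡sumOver² s (suc m) ⟩
  sumOver² Cs Cs EMD
    ≡⟨ sumOver-compositions-cong s (suc m) (λ α Σα → sumOver-compositions-cong s (suc m) (λ β Σβ → split α β Σα Σβ)) ⟩
  sumOver² Cs Cs (λ α β → Σ< (suc s) (λ r → w r α β))
    ≡⟨ trans (sumOver-cong Cs (λ α → sumOver-Σ< Cs (suc s) (λ β r → w r α β))) (sumOver-Σ< Cs (suc s) _) ⟩
  Σ< (suc s) (λ r → sumOver² Cs Cs (w r))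
    ≡⟨ Σ<-cong (suc s) (λ r r<1+s → emdFormula-term s m r (s≤s⁻¹ r<1+s)) ⟩
  emdFormula s m ∎
  where
  M = s + m
  Cs = compositions s (suc m)
  w : ℕ → Vec ℕ (suc m) → Vec ℕ (suc m) → ℕ
  w r α β = 𝟙[ r ≤ m ] * (inClass M (s ∸ r) (m ∸ r) r r α β * offsetDistance 0 0 M α β)
  split : ∀ α β → sumᵥ α ≡ s → sumᵥ β ≡ s → EMD α β ≡ Σ< (suc s) (λ r → w r α β)
  split α β Σα Σβ = begin
    EMD α β                                                  ≡⟨ EMD≡Σ<∣starsIn-starsIn∣ s m α β Σα Σβ ⟩
    offsetDistance 0 0 M α β                                 ≡⟨ sym (*-identityˡ _) ⟩
    1 * offsetDistance 0 0 M α β                             ≡⟨ cong (_* offsetDistance 0 0 M α β) (sym (PairCounts.Σ<-inClass s m α β Σα Σβ)) ⟩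
    Σ< (suc s) (λ r → 𝟙[ r ≤ m ] * inClass M (s ∸ r) (m ∸ r) r r α β) * offsetDistance 0 0 M α β
                                                             ≡⟨ sym (Σ<-*ʳ (suc s) _ _) ⟩
    Σ< (suc s) (λ r → 𝟙[ r ≤ m ] * inClass M (s ∸ r) (m ∸ r) r r α β * offsetDistance 0 0 M α β)
                                                             ≡⟨ Σ<-cong′ (suc s) (λ r → *-assoc 𝟙[ r ≤ m ] _ _) ⟩
    Σ< (suc s) (λ r → w r α β) ∎

theorem4p3 : (s n : ℕ) → n ≥ 1 →
    totalEMD s n * ((4 * s + 4 * n ∸ 2) * (((s + n ∸ 1) C s) * ((s + n ∸ 1) C s)))
      ≡ (s * (n ∸ 1)) * ((2 * s + 2 * n) C (2 * s + 1))
          * (numCompositions s n * numCompositions s n)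
theorem4p3 s (suc m) _ = begin
  totalEMD s (suc m) * (K * (c′ * c′))   ≡⟨ cong₂ (λ a b → a * (K * (b * b))) (totalEMD≡emdFormula s m) count ⟩
  emdFormula s m * (K * (c * c))         ≡⟨ sym (*-assoc (emdFormula s m) K (c * c)) ⟩
  emdFormula s m * K * (c * c)           ≡⟨ cong (_* (c * c)) (emdFormula-closed s m) ⟩
  s * m * binom (2 * s + 2 * suc m) (2 * s + 1) * (c * c)
    ≡⟨ cong₂ (λ a b → s * m * a * (b * b)) (binom≡C (2 * s + 2 * suc m) (2 * s + 1)) (sym (length-compositions s m)) ⟩
  s * m * ((2 * s + 2 * suc m) C (2 * s + 1)) * (numCompositions s (suc m) * numCompositions s (suc m)) ∎
  where
  K = 4 * s + 4 * suc m ∸ 2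
  c′ = (s + suc m ∸ 1) C s
  c = binom (s + m) s
  count : c′ ≡ c
  count = trans (cong (λ z → (z ∸ 1) C s) (+-suc s m)) (sym (binom≡C (s + m) s))
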